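{- For all integers $n\geq 2$ and $k\geq 2$, the local antimagic chromatic number of the firecracker graph $F_{n,k}$ is $$\chi_{la}(F_{n,k})=nk-n+1.$$
   Context: All graphs are finite, simple and connected. For a graph $G$ with $m$ edges, a bijection $f:E(G)\to\{1,2,\dots,m\}$ is a local antimagic labeling if $\omega(u)\neq\omega(v)$ for every edge $uv$, where $\omega(u)=\sum_{e\in E(u)}f(e)$ and $E(u)$ is the set of edges incident with $u$. Assigning color $\omega(v)$ to each vertex gives a proper vertex coloring; the local antimagic chromatic number $\chi_{la}(G)$ is the minimum number of distinct colors (values of $\omega$) over all local antimagic labelings of $G$. The firecracker graph $F_{n,k}$ has vertex set $\{u_i:1\le i\le n\}\cup\{v_{i,j}:1\le i\le n,1\le j\le k\}$ and edge set $\{v_{i,1}v_{i+1,1}:1\le i\le n-1\}\cup\{u_iv_{i,j}:1\le i\le n,1\le j\le k\}$ (i.e. $n$ copies of the star $K_{1,k}$ with one leaf of each linked in a path). -}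

module Defs where

open import Data.Nat using (ℕ; zero; suc; _+_; _*_; _∸_; _≤_; _≡ᵇ_)
open import Data.Nat.Properties using (_≟_)
open import Data.Bool using (Bool; if_then_else_; _∨_)
open import Data.Fin using (Fin; toℕ)
open import Data.List using (List; []; _∷_; map; upTo; allFin; length; lookup; concatMap; deduplicate; _++_)
open import Data.Product using (Σ; _×_; _,_; proj₁; proj₂)
open import Relation.Binary.PropositionalEquality using (_≡_; _≢_)
open import Function.Definitions using (Bijective)
open import Data.Nat.ListAction using (sum)

-- A (finite) graph: vertices are 0 .. V-1, edges an explicit list of
-- unordered pairs of vertices (each pair listed once).
record Graph : Set where
  constructor mkGraph
  field
    V     : ℕ
    edges : List (ℕ × ℕ)

open Graph public

numEdges : Graph → ℕ
numEdges G = length (edges G)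

-- An edge labeling assigns to edge number e (in Fin m) a value in Fin m;
-- the actual label is toℕ (f e) + 1, so labels range over {1,…,m}.
Labeling : Graph → Set
Labeling G = Fin (numEdges G) → Fin (numEdges G)

label : (G : Graph) → Labeling G → Fin (numEdges G) → ℕ
label G f e = suc (toℕ (f e))

incident : ℕ → ℕ × ℕ → Bool
incident x (a , b) = (a ≡ᵇ x) ∨ (b ≡ᵇ x)

weight : (G : Graph) → Labeling G → ℕ → ℕ
weight G f x =
  sum (map (λ e → if incident x (lookup (edges G) e) then label G f e else 0)
           (allFin (numEdges G)))

IsLocalAntimagic : (G : Graph) → Labeling G → Set
IsLocalAntimagic G f =
  Bijective _≡_ _≡_ f ×
  ((e : Fin (numEdges G)) →
     weight G f (proj₁ (lookup (edges G) e)) ≢ weight G f (proj₂ (lookup (edges G) e)))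

numColors : (G : Graph) → Labeling G → ℕ
numColors G f = length (deduplicate _≟_ (map (weight G f) (upTo (V G))))

LocalAntimagicChromaticNumber : Graph → ℕ → Set
LocalAntimagicChromaticNumber G c =
  Σ (Labeling G) (λ f → IsLocalAntimagic G f × numColors G f ≡ c) ×
  ((f : Labeling G) → IsLocalAntimagic G f → c ≤ numColors G f)

-- Firecracker graph F_{n,k}, 0-indexed encoding:
--   u_i      ↦ i                    (0 ≤ i < n)
--   v_{i,j}  ↦ n + i * k + j        (0 ≤ i < n, 0 ≤ j < k); v_{i,1} is j = 0
-- edges: v_{i,1} v_{i+1,1} (0 ≤ i < n-1) and u_i v_{i,j}.
firecracker : ℕ → ℕ → Graph
firecracker n k = mkGraph (n + n * k) (pathEdges ++ starEdges)
  where
  vtx : ℕ → ℕ → ℕ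
  vtx i j = n + i * k + j
  pathEdges : List (ℕ × ℕ)
  pathEdges = map (λ i → (vtx i 0 , vtx (suc i) 0)) (upTo (n ∸ 1))
  starEdges : List (ℕ × ℕ)
  starEdges = concatMap (λ i → map (λ j → (i , vtx i j)) (upTo k)) (upTo n)

module Submission where

-- Lower bound: the n(k − 1) leaves v_{i,j} (j ≥ 2) are pendant, so their weights are their own
-- labels, which are distinct and at most m = n − 1 + nk. The edge labelled m has an endpoint of
-- degree at least 2, whose weight therefore exceeds m.
--
-- Upper bound: call a labelling a scheme if all centres have the same weight c > m and the weight of
-- every path vertex v_{i,1} is a leaf label, adjacent path vertices having different weights. Its
-- colours are c and the n(k − 1) leaf labels. Giving the i-th star two new leaves labelled m + i and
-- m + 2n + 1 − i adds the same amount to every centre and turns a scheme for F_{n,k} into one for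
-- F_{n,k+2}, so schemes for two consecutive values of k suffice. For n ≥ 5 there are explicit
-- families for k = 2, 3; for n ≤ 4 there are tables, with k = 3, 4 when n = 3 since F_{3,2} has no
-- scheme; F_{3,2} itself is labelled directly.

open import Data.Bool using (if_then_else_)
open import Data.Fin as Fin using (Fin; toℕ; fromℕ<; punchOut)
open import Data.Fin.Properties
  using (toℕ<n; toℕ-fromℕ<; fromℕ<-toℕ; toℕ-injective; any?; all?; injective⇒≤; punchOut-injective)
open import Data.List using (List; []; _∷_; map; _++_; length; lookup; tabulate; applyUpTo; upTo; concatMap; deduplicate)
open import Data.List.Membership.Propositional using (_∈_; find)
open import Data.List.Membership.Propositional.Properties
  using ( ∈-lookup; ∈-∃++; ∈-++⁻; ∈-++⁺ˡ; ∈-++⁺ʳ; ∈-map⁻; ∈-map⁺; ∈-upTo⁻; ∈-upTo⁺; ∈-applyUpTo⁻; ∈-applyUpTo⁺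
        ; ∈-deduplicate⁻; ∈-deduplicate⁺; ∈-concatMap⁻)
open import Data.List.Properties using (map-tabulate; length-++; length-map; length-applyUpTo)
import Data.List.Relation.Unary.All as All
open import Data.List.Relation.Unary.AllPairs using (_∷_)
open import Data.List.Relation.Unary.Any using (here; there)
open import Data.List.Relation.Unary.Unique.DecPropositional.Properties using (deduplicate-!)
open import Data.List.Relation.Unary.Unique.Propositional using (Unique)
open import Data.List.Relation.Unary.Unique.Propositional.Properties using (applyUpTo⁺₁)
open import Data.Nat
  using (ℕ; zero; suc; pred; _+_; _*_; _∸_; _≤_; _<_; _≡ᵇ_; _<ᵇ_; z≤n; s≤s; s≤s⁻¹; NonZero; >-nonZero; >-nonZero⁻¹)
open import Data.Nat.DivMod
  using (_/_; _%_; +-distrib-/-∣ˡ; m*n/n≡m; m<n⇒m/n≡0; [m+kn]%n≡m%n; m<n⇒m%n≡m; m≡m%n+[m/n]*n; m<n*o⇒m/o<n; m%n<n)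
open import Data.Nat.Divisibility using (divides)
open import Data.Nat.ListAction using (sum)
open import Data.Nat.Properties
open import Algebra.Properties.CommutativeSemigroup +-commutativeSemigroup using (interchange)
open import Data.Nat.Tactic.RingSolver using (solve-∀)
open import Data.Product using (Σ; ∃; _×_; _,_; proj₁; proj₂)
open import Data.Sum using (_⊎_; inj₁; inj₂)
open import Defs
open import Function using (_∘_; id)
open import Function.Definitions using (Injective; Surjective; Bijective)
open import Relation.Binary.Definitions using (tri<; tri≈; tri>)
open import Relation.Binary.PropositionalEquality
open import Relation.Nullary using (Dec; yes; no; ¬?; contradiction)
open import Relation.Nullary.Decidable using (True; toWitness; from-yes; dec-true; dec-false; _×-dec_; _→-dec_)

Σ< : ℕ → (ℕ → ℕ) → ℕ
Σ< zero    h = 0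
Σ< (suc r) h = h 0 + Σ< r (h ∘ suc)

Σ<-cong : ∀ r {h h′} → (∀ {t} → t < r → h t ≡ h′ t) → Σ< r h ≡ Σ< r h′
Σ<-cong zero    eq = refl
Σ<-cong (suc r) eq = cong₂ _+_ (eq (s≤s z≤n)) (Σ<-cong r (eq ∘ s≤s))

Σ<-zero : ∀ r h → (∀ {t} → t < r → h t ≡ 0) → Σ< r h ≡ 0
Σ<-zero r h eq = trans (Σ<-cong r eq) (Σ<-const0 r)
  where
  Σ<-const0 : ∀ r → Σ< r (λ _ → 0) ≡ 0
  Σ<-const0 zero    = refl
  Σ<-const0 (suc r) = Σ<-const0 r

Σ<-single : ∀ r h {t₀} → t₀ < r → (∀ {t} → t < r → t ≢ t₀ → h t ≡ 0) → Σ< r h ≡ h t₀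
Σ<-single (suc r) h {zero} _ others =
  trans (cong (h 0 +_) (Σ<-zero r (h ∘ suc) (λ t<r → others (s≤s t<r) λ ()))) (+-identityʳ (h 0))
Σ<-single (suc r) h {suc t₀} (s≤s t₀<r) others =
  cong₂ _+_ (others (s≤s z≤n) λ ())
            (Σ<-single r (h ∘ suc) t₀<r λ t<r t≢t₀ → others (s≤s t<r) (t≢t₀ ∘ suc-injective))

Σ<-+ : ∀ r h h′ → Σ< r (λ t → h t + h′ t) ≡ Σ< r h + Σ< r h′
Σ<-+ zero    h h′ = refl
Σ<-+ (suc r) h h′ = trans (cong (h 0 + h′ 0 +_) (Σ<-+ r (h ∘ suc) (h′ ∘ suc))) (interchange (h 0) (h′ 0) _ _)

Σ<-split : ∀ a b h → Σ< (a + b) h ≡ Σ< a h + Σ< b (λ t → h (a + t))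
Σ<-split zero    b h = refl
Σ<-split (suc a) b h = trans (cong (h 0 +_) (Σ<-split a b (h ∘ suc))) (sym (+-assoc (h 0) _ _))

Σ<-indicator : ∀ r i (h : ℕ → ℕ) → Σ< r (λ t → if t ≡ᵇ i then h t else 0) ≡ (if i <ᵇ r then h i else 0)
Σ<-indicator zero    i       h = refl
Σ<-indicator (suc r) zero    h = trans (cong (h 0 +_) (Σ<-zero r (λ _ → 0) λ _ → refl)) (+-identityʳ (h 0))
Σ<-indicator (suc r) (suc i) h = Σ<-indicator r i (h ∘ suc)

Σ<-pair≤ : ∀ r h {t₁ t₂} → t₁ < t₂ → t₂ < r → h t₁ + h t₂ ≤ Σ< r h
Σ<-pair≤ (suc r) h {zero}   {suc t₂} _          (s≤s t₂<r) = +-monoʳ-≤ (h 0) (term≤Σ< r (h ∘ suc) t₂<r)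
  where
  term≤Σ< : ∀ r h {t} → t < r → h t ≤ Σ< r h
  term≤Σ< (suc r) h {zero}  _         = m≤m+n (h 0) _
  term≤Σ< (suc r) h {suc t} (s≤s t<r) = ≤-trans (term≤Σ< r (h ∘ suc) t<r) (m≤n+m _ (h 0))
Σ<-pair≤ (suc r) h {suc t₁} {suc t₂} (s≤s t₁<t₂) (s≤s t₂<r) =
  ≤-trans (Σ<-pair≤ r (h ∘ suc) t₁<t₂ t₂<r) (m≤n+m _ (h 0))

contribution : ℕ → ℕ × ℕ → ℕ → ℕ
contribution x e y = if incident x e then y else 0

contribution-absent : ∀ {x a b} y → a ≢ x → b ≢ x → contribution x (a , b) y ≡ 0
contribution-absent {x} {a} {b} y a≢x b≢x rewrite dec-false (a ≟ x) a≢x | dec-false (b ≟ x) b≢x = refl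

contribution-fst : ∀ {x} b y → contribution x (x , b) y ≡ y
contribution-fst {x} b y rewrite dec-true (x ≟ x) refl = refl

contribution-snd : ∀ {x a} y → a ≢ x → contribution x (a , x) y ≡ y
contribution-snd {x} {a} y a≢x rewrite dec-false (a ≟ x) a≢x | dec-true (x ≟ x) refl = refl

contribution-split : ∀ {x a b} y → (a ≡ x → b ≢ x) →
  contribution x (a , b) y ≡ (if a ≡ᵇ x then y else 0) + (if b ≡ᵇ x then y else 0)
contribution-split {x} {a} {b} y excl with a ≟ x
... | yes a≡x rewrite dec-true (a ≟ x) a≡x | dec-false (b ≟ x) (excl a≡x) = sym (+-identityʳ y)
... | no  a≢x rewrite dec-false (a ≟ x) a≢x = refl

≡ᵇ-injective : ∀ (g : ℕ → ℕ) → (∀ {a b} → g a ≡ g b → a ≡ b) → ∀ a b → (g a ≡ᵇ g b) ≡ (a ≡ᵇ b)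
≡ᵇ-injective g g-injective a b with a ≟ b
... | yes refl = trans (dec-true (g a ≟ g a) refl) (sym (dec-true (a ≟ a) refl))
... | no  a≢b  = trans (dec-false (g a ≟ g b) (a≢b ∘ g-injective)) (sym (dec-false (a ≟ b) a≢b))

incidenceSum : ℕ → List (ℕ × ℕ) → (ℕ → ℕ) → ℕ
incidenceSum x []       L = 0
incidenceSum x (e ∷ es) L = contribution x e (L 0) + incidenceSum x es (L ∘ suc)

weight≡incidenceSum : ∀ G f (L : ℕ → ℕ) → (∀ e → label G f e ≡ L (toℕ e)) →
                      ∀ x → weight G f x ≡ incidenceSum x (edges G) L
weight≡incidenceSum G f L label≡ x = trans
  (cong sum (map-tabulate {n = numEdges G} id (λ e → contribution x (lookup (edges G) e) (label G f e))))
  (tabulate≡ (edges G) (label G f) L label≡)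
  where
  tabulate≡ : ∀ es (F : Fin (length es) → ℕ) L → (∀ e → F e ≡ L (toℕ e)) →
              sum (tabulate (λ e → contribution x (lookup es e) (F e))) ≡ incidenceSum x es L
  tabulate≡ []       F L F≡ = refl
  tabulate≡ (e ∷ es) F L F≡ =
    cong₂ _+_ (cong (contribution x e) (F≡ Fin.zero)) (tabulate≡ es (F ∘ Fin.suc) (L ∘ suc) (F≡ ∘ Fin.suc))

incidenceSum-cong : ∀ x es {L L′} → (∀ t → L t ≡ L′ t) → incidenceSum x es L ≡ incidenceSum x es L′
incidenceSum-cong x []       eq = refl
incidenceSum-cong x (e ∷ es) eq = cong₂ _+_ (cong (contribution x e) (eq 0)) (incidenceSum-cong x es (eq ∘ suc))

incidenceSum-++ : ∀ x es es′ L →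
  incidenceSum x (es ++ es′) L ≡ incidenceSum x es L + incidenceSum x es′ (λ t → L (length es + t))
incidenceSum-++ x []       es′ L = refl
incidenceSum-++ x (e ∷ es) es′ L =
  trans (cong (contribution x e (L 0) +_) (incidenceSum-++ x es es′ (L ∘ suc)))
        (sym (+-assoc (contribution x e (L 0)) (incidenceSum x es (L ∘ suc)) _))

incidenceSum-map : ∀ x (g : ℕ → ℕ × ℕ) (φ : ℕ → ℕ) r L →
  incidenceSum x (map g (applyUpTo φ r)) L ≡ Σ< r (λ t → contribution x (g (φ t)) (L t))
incidenceSum-map x g φ zero    L = refl
incidenceSum-map x g φ (suc r) L = cong (contribution x (g (φ 0)) (L 0) +_) (incidenceSum-map x g (φ ∘ suc) r (L ∘ suc))

incidenceSum-concatMap : ∀ x k (row : ℕ → List (ℕ × ℕ)) → (∀ i → length (row i) ≡ k) → ∀ g r L →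
  incidenceSum x (concatMap row (applyUpTo g r)) L ≡ Σ< r (λ i → incidenceSum x (row (g i)) (λ j → L (i * k + j)))
incidenceSum-concatMap x k row len g zero    L = refl
incidenceSum-concatMap x k row len g (suc r) L = begin
  incidenceSum x (row (g 0) ++ concatMap row (applyUpTo (g ∘ suc) r)) L
    ≡⟨ incidenceSum-++ x (row (g 0)) _ L ⟩
  incidenceSum x (row (g 0)) L + incidenceSum x (concatMap row (applyUpTo (g ∘ suc) r)) (λ t → L (length (row (g 0)) + t))
    ≡⟨ cong (incidenceSum x (row (g 0)) L +_) (trans
         (cong (λ ℓ → incidenceSum x (concatMap row (applyUpTo (g ∘ suc) r)) (λ t → L (ℓ + t))) (len (g 0)))
         (incidenceSum-concatMap x k row len (g ∘ suc) r (λ t → L (k + t)))) ⟩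
  incidenceSum x (row (g 0)) L + Σ< r (λ i → incidenceSum x (row (g (suc i))) (λ j → L (k + (i * k + j))))
    ≡⟨ cong (incidenceSum x (row (g 0)) L +_)
         (Σ<-cong r λ {i} _ → incidenceSum-cong x (row (g (suc i))) λ j → cong L (sym (+-assoc k (i * k) j))) ⟩
  Σ< (suc r) (λ i → incidenceSum x (row (g i)) (λ j → L (i * k + j))) ∎
  where open ≡-Reasoning

length-concatMap : ∀ k (row : ℕ → List (ℕ × ℕ)) → (∀ i → length (row i) ≡ k) → ∀ g r →
                   length (concatMap row (applyUpTo g r)) ≡ r * k
length-concatMap k row len g zero    = refl
length-concatMap k row len g (suc r) =
  trans (length-++ (row (g 0))) (cong₂ _+_ (len (g 0)) (length-concatMap k row len (g ∘ suc) r))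

Unique⇒length≤ : ∀ {A : Set} {xs ys : List A} → Unique xs → (∀ {a} → a ∈ xs → a ∈ ys) → length xs ≤ length ys
Unique⇒length≤ {xs = []}     _            _   = z≤n
Unique⇒length≤ {xs = x ∷ xs} (x∉xs ∷ uxs) xs⊆ys with ∈-∃++ (xs⊆ys (here refl))
... | ys₁ , ys₂ , refl = begin
  suc (length xs)           ≤⟨ s≤s (Unique⇒length≤ uxs xs⊆ys₁++ys₂) ⟩
  suc (length (ys₁ ++ ys₂)) ≡⟨ cong suc (length-++ ys₁) ⟩
  suc (length ys₁ + length ys₂) ≡⟨ sym (+-suc (length ys₁) (length ys₂)) ⟩
  length ys₁ + length (x ∷ ys₂) ≡⟨ sym (length-++ ys₁) ⟩
  length (ys₁ ++ x ∷ ys₂) ∎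
  where
  open ≤-Reasoning
  xs⊆ys₁++ys₂ : ∀ {a} → a ∈ xs → a ∈ ys₁ ++ ys₂
  xs⊆ys₁++ys₂ {a} a∈xs with ∈-++⁻ ys₁ (xs⊆ys (there a∈xs))
  ... | inj₁ a∈ys₁         = ∈-++⁺ˡ a∈ys₁
  ... | inj₂ (here a≡x)    = contradiction (sym a≡x) (All.lookup x∉xs a∈xs)
  ... | inj₂ (there a∈ys₂) = ∈-++⁺ʳ ys₁ a∈ys₂

countDistinct : (ℕ → ℕ) → ℕ → ℕ
countDistinct W V = length (deduplicate _≟_ (map W (upTo V)))

countDistinct≤ : ∀ W V N (g : ℕ → ℕ) → (∀ {v} → v < V → ∃ λ s → s < N × W v ≡ g s) → countDistinct W V ≤ N
countDistinct≤ W V N g covered = subst (countDistinct W V ≤_) (length-applyUpTo g N)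
  (Unique⇒length≤ (deduplicate-! _≟_ (map W (upTo V))) values⊆)
  where
  values⊆ : ∀ {a} → a ∈ deduplicate _≟_ (map W (upTo V)) → a ∈ applyUpTo g N
  values⊆ a∈ with ∈-map⁻ W (∈-deduplicate⁻ _≟_ (map W (upTo V)) a∈)
  ... | v , v∈ , refl with covered (∈-upTo⁻ v∈)
  ... | s , s<N , Wv≡gs = subst (_∈ applyUpTo g N) (sym Wv≡gs) (∈-applyUpTo⁺ g s<N)

≤countDistinct : ∀ W V N (g : ℕ → ℕ) → (∀ {s s′} → s < s′ → s′ < N → g s ≢ g s′) →
                 (∀ {s} → s < N → ∃ λ v → v < V × W v ≡ g s) → N ≤ countDistinct W V
≤countDistinct W V N g g-distinct attained = subst (_≤ countDistinct W V) (length-applyUpTo g N)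
  (Unique⇒length≤ (applyUpTo⁺₁ g N g-distinct) values⊆)
  where
  values⊆ : ∀ {a} → a ∈ applyUpTo g N → a ∈ deduplicate _≟_ (map W (upTo V))
  values⊆ a∈ with ∈-applyUpTo⁻ g a∈
  ... | s , s<N , refl with attained s<N
  ... | v , v<V , Wv≡gs = subst (_∈ deduplicate _≟_ (map W (upTo V))) Wv≡gs
                            (∈-deduplicate⁺ _≟_ (∈-map⁺ W (∈-upTo⁺ v<V)))

injective⇒surjective : ∀ {m} (f : Fin m → Fin m) → Injective _≡_ _≡_ f → Surjective _≡_ _≡_ f
injective⇒surjective {suc m} f f-injective y with any? (λ x → f x Fin.≟ y)
... | yes (x , fx≡y) = x , λ z≡x → trans (cong f z≡x) fx≡y
... | no  y∉image     = contradiction (injective⇒≤ squeeze-injective) 1+n≰n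
  where
  y≢f : ∀ x → y ≢ f x
  y≢f x y≡fx = y∉image (x , sym y≡fx)
  squeeze : Fin (suc m) → Fin m
  squeeze x = punchOut (y≢f x)
  squeeze-injective : Injective _≡_ _≡_ squeeze
  squeeze-injective eq = f-injective (punchOut-injective (y≢f _) (y≢f _) eq)

injective⇒surjective-< : ∀ {n} (h : ℕ → ℕ) → (∀ {i} → i < n → h i < n) →
  (∀ {i i′} → i < n → i′ < n → h i ≡ h i′ → i ≡ i′) → ∀ {x} → x < n → ∃ λ i → i < n × h i ≡ x
injective⇒surjective-< {n} h h< h-injective {x} x<n =
  let i , hᶠi≡x = injective⇒surjective hᶠ hᶠ-injective (fromℕ< x<n)
  in  toℕ i , toℕ<n i , trans (sym (toℕ-hᶠ i)) (trans (cong toℕ (hᶠi≡x refl)) (toℕ-fromℕ< x<n))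
  where
  hᶠ : Fin n → Fin n
  hᶠ i = fromℕ< (h< (toℕ<n i))
  toℕ-hᶠ : ∀ i → toℕ (hᶠ i) ≡ h (toℕ i)
  toℕ-hᶠ i = toℕ-fromℕ< (h< (toℕ<n i))
  hᶠ-injective : Injective _≡_ _≡_ hᶠ
  hᶠ-injective {i} {i′} eq =
    toℕ-injective (h-injective (toℕ<n i) (toℕ<n i′) (trans (sym (toℕ-hᶠ i)) (trans (cong toℕ eq) (toℕ-hᶠ i′))))

module _ (G : Graph) where

  labelAt : Labeling G → ℕ → ℕ
  labelAt f t with t <? numEdges G
  ... | yes t<m = label G f (fromℕ< t<m)
  ... | no  _   = 0

  label≡labelAt : ∀ f e → label G f e ≡ labelAt f (toℕ e)
  label≡labelAt f e with toℕ e <? numEdges G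
  ... | yes t<m = cong (label G f) (sym (fromℕ<-toℕ e t<m))
  ... | no  t≮m = contradiction (toℕ<n e) t≮m

  labelAt-fromℕ< : ∀ f {t} (t<m : t < numEdges G) → labelAt f t ≡ label G f (fromℕ< t<m)
  labelAt-fromℕ< f t<m = trans (cong (labelAt f) (sym (toℕ-fromℕ< t<m))) (sym (label≡labelAt f (fromℕ< t<m)))

  labelAt-bounds : ∀ f {t} → t < numEdges G → 1 ≤ labelAt f t × labelAt f t ≤ numEdges G
  labelAt-bounds f t<m rewrite labelAt-fromℕ< f t<m = s≤s z≤n , toℕ<n (f (fromℕ< t<m))

  labelAt-injective : ∀ {f} → Injective _≡_ _≡_ f → ∀ {t t′} → t < numEdges G → t′ < numEdges G →
                      labelAt f t ≡ labelAt f t′ → t ≡ t′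
  labelAt-injective {f} f-injective {t} {t′} t<m t′<m eq = begin
    t                   ≡⟨ toℕ-fromℕ< t<m ⟨
    toℕ (fromℕ< t<m)    ≡⟨ cong toℕ (f-injective (toℕ-injective (suc-injective labels≡))) ⟩
    toℕ (fromℕ< t′<m)   ≡⟨ toℕ-fromℕ< t′<m ⟩
    t′                  ∎
    where
    open ≡-Reasoning
    labels≡ : label G f (fromℕ< t<m) ≡ label G f (fromℕ< t′<m)
    labels≡ = trans (sym (labelAt-fromℕ< f t<m)) (trans eq (labelAt-fromℕ< f t′<m))

  labelAt-top : ∀ {f} → Surjective _≡_ _≡_ f → 0 < numEdges G → ∃ λ t → t < numEdges G × labelAt f t ≡ numEdges G
  labelAt-top {f} f-surjective 0<m =
    let e , fe≡top = f-surjective top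
    in  toℕ e , toℕ<n e , (begin
          labelAt f (toℕ e)  ≡⟨ label≡labelAt f e ⟨
          suc (toℕ (f e))    ≡⟨ cong (suc ∘ toℕ) (fe≡top refl) ⟩
          suc (toℕ top)      ≡⟨ cong suc (toℕ-fromℕ< top<m) ⟩
          suc (pred m)       ≡⟨ suc-pred m ⟩
          m                  ∎)
    where
    open ≡-Reasoning
    m : ℕ
    m = numEdges G
    instance
      m-nonZero : NonZero m
      m-nonZero = >-nonZero 0<m
    top<m : pred m < m
    top<m = ≤-reflexive (suc-pred m)
    top : Fin m
    top = fromℕ< top<m

  module _ (L : ℕ → ℕ) (L-bounds : ∀ {t} → t < numEdges G → 1 ≤ L t × L t ≤ numEdges G) where

    labelingFrom : Labeling G
    labelingFrom e = fromℕ< (pred<m (L-bounds (toℕ<n e)))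
      where
      pred<m : ∀ {x} → 1 ≤ x × x ≤ numEdges G → pred x < numEdges G
      pred<m {suc x} (_ , x<m) = x<m

    label-labelingFrom : ∀ e → label G labelingFrom e ≡ L (toℕ e)
    label-labelingFrom e = trans (cong suc (toℕ-fromℕ< _)) (suc-pred′ (L-bounds (toℕ<n e)))
      where
      suc-pred′ : ∀ {x} → 1 ≤ x × x ≤ numEdges G → suc (pred x) ≡ x
      suc-pred′ {suc x} _ = refl

    labelingFrom-bijective : (∀ {t t′} → t < numEdges G → t′ < numEdges G → L t ≡ L t′ → t ≡ t′) →
                             Bijective _≡_ _≡_ labelingFrom
    labelingFrom-bijective L-injective = injective , injective⇒surjective labelingFrom injective
      where
      injective : Injective _≡_ _≡_ labelingFrom
      injective {e} {e′} eq = toℕ-injective (L-injective (toℕ<n e) (toℕ<n e′) (begin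
        L (toℕ e)                  ≡⟨ label-labelingFrom e ⟨
        suc (toℕ (labelingFrom e))  ≡⟨ cong (suc ∘ toℕ) eq ⟩
        suc (toℕ (labelingFrom e′)) ≡⟨ label-labelingFrom e′ ⟩
        L (toℕ e′)                 ∎))
        where open ≡-Reasoning

module _ (k : ℕ) .{{_ : NonZero k}} where

  [i*k+j]/k≡i : ∀ i {j} → j < k → (i * k + j) / k ≡ i
  [i*k+j]/k≡i i {j} j<k = begin
    (i * k + j) / k    ≡⟨ +-distrib-/-∣ˡ j (divides i refl) ⟩
    i * k / k + j / k  ≡⟨ cong₂ _+_ (m*n/n≡m i k) (m<n⇒m/n≡0 j<k) ⟩
    i + 0              ≡⟨ +-identityʳ i ⟩
    i                  ∎
    where open ≡-Reasoning

  [i*k+j]%k≡j : ∀ i {j} → j < k → (i * k + j) % k ≡ j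
  [i*k+j]%k≡j i {j} j<k = begin
    (i * k + j) % k  ≡⟨ cong (_% k) (+-comm (i * k) j) ⟩
    (j + i * k) % k  ≡⟨ [m+kn]%n≡m%n j i k ⟩
    j % k            ≡⟨ m<n⇒m%n≡m j<k ⟩
    j                ∎
    where open ≡-Reasoning

  *+-injective : ∀ {i j i′ j′} → j < k → j′ < k → i * k + j ≡ i′ * k + j′ → i ≡ i′ × j ≡ j′
  *+-injective {i} {j} {i′} {j′} j<k j′<k eq =
    trans (sym ([i*k+j]/k≡i i j<k)) (trans (cong (_/ k) eq) ([i*k+j]/k≡i i′ j′<k)) ,
    trans (sym ([i*k+j]%k≡j i j<k)) (trans (cong (_% k) eq) ([i*k+j]%k≡j i′ j′<k))

  *+-< : ∀ {n i j} → i < n → j < k → i * k + j < n * k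
  *+-< {n} {i} {j} i<n j<k = begin-strict
    i * k + j  <⟨ +-monoʳ-< (i * k) j<k ⟩
    i * k + k  ≡⟨ +-comm (i * k) k ⟩
    suc i * k  ≤⟨ *-monoˡ-≤ k i<n ⟩
    n * k      ∎
    where open ≤-Reasoning

  *+-decompose : ∀ s → s ≡ s / k * k + s % k
  *+-decompose s = trans (m≡m%n+[m/n]*n s k) (+-comm (s % k) _)

  *+-surjective : ∀ {n s} → s < n * k → ∃ λ i → ∃ λ j → i < n × j < k × s ≡ i * k + j
  *+-surjective {n} {s} s<nk = s / k , s % k , m<n*o⇒m/o<n s<nk , m%n<n s k , *+-decompose s

split-<+ : ∀ a {b v} → v < a + b → v < a ⊎ ∃ λ s → s < b × v ≡ a + s
split-<+ a {b} {v} v<a+b with v <? a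
... | yes v<a = inj₁ v<a
... | no  v≮a = inj₂ (v ∸ a , +-cancelˡ-< a _ _ (subst (_< a + b) v≡ v<a+b) , v≡)
  where
  v≡ : v ≡ a + (v ∸ a)
  v≡ = sym (m+[n∸m]≡n (≮⇒≥ v≮a))

edgeCount : ℕ → ℕ → ℕ
edgeCount n₁ k = n₁ + suc n₁ * k

pathLeft : (ℕ → ℕ) → ℕ → ℕ
pathLeft a zero    = 0
pathLeft a (suc i) = a i

module Firecracker (n₁ k′ : ℕ) .{{_ : NonZero k′}} where

  n k m : ℕ
  n = suc n₁
  k = suc k′
  m = edgeCount n₁ k

  FG : Graph
  FG = firecracker n k

  vtx : ℕ → ℕ → ℕ
  vtx i j = n + i * k + j

  pathEdge : ℕ → ℕ × ℕ
  pathEdge t = vtx t 0 , vtx (suc t) 0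

  starEdge : ℕ → ℕ → ℕ × ℕ
  starEdge i j = i , vtx i j

  starRow : ℕ → List (ℕ × ℕ)
  starRow i = map (starEdge i) (upTo k)

  starPos : ℕ → ℕ → ℕ
  starPos i j = n₁ + (i * k + j)

  length-pathEdges : length (map pathEdge (upTo n₁)) ≡ n₁
  length-pathEdges = trans (length-map pathEdge (upTo n₁)) (length-applyUpTo id n₁)

  length-starRow : ∀ i → length (starRow i) ≡ k
  length-starRow i = trans (length-map (starEdge i) (upTo k)) (length-applyUpTo id k)

  numEdges-FG : numEdges FG ≡ m
  numEdges-FG = trans (length-++ (map pathEdge (upTo n₁)))
    (cong₂ _+_ length-pathEdges (length-concatMap k starRow length-starRow id n))

  vtx-injective : ∀ {i j i′ j′} → j < k → j′ < k → vtx i j ≡ vtx i′ j′ → i ≡ i′ × j ≡ j′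
  vtx-injective {i} {j} {i′} {j′} j<k j′<k eq = *+-injective k j<k j′<k
    (+-cancelˡ-≡ n _ _ (trans (sym (+-assoc n (i * k) j)) (trans eq (+-assoc n (i′ * k) j′))))

  vtx≢centre : ∀ {x} i j → x < n → vtx i j ≢ x
  vtx≢centre i j x<n refl = <⇒≱ x<n (≤-trans (m≤m+n n (i * k)) (m≤m+n _ j))

  vertex-cases : ∀ {v} → v < n + n * k → v < n ⊎ ∃ λ i → ∃ λ j → i < n × j < k × v ≡ vtx i j
  vertex-cases v<V with split-<+ n v<V
  ... | inj₁ v<n = inj₁ v<n
  ... | inj₂ (s , s<nk , refl) with *+-surjective k {n} s<nk
  ...   | i , j , i<n , j<k , refl = inj₂ (i , j , i<n , j<k , sym (+-assoc n (i * k) j))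

  position-cases : ∀ {t} → t < m → t < n₁ ⊎ ∃ λ i → ∃ λ j → i < n × j < k × t ≡ starPos i j
  position-cases t<m with split-<+ n₁ t<m
  ... | inj₁ t<n₁ = inj₁ t<n₁
  ... | inj₂ (s , s<nk , refl) with *+-surjective k {n} s<nk
  ...   | i , j , i<n , j<k , refl = inj₂ (i , j , i<n , j<k , refl)

  edge-cases : ∀ {e} → e ∈ edges FG →
    (∃ λ t → t < n₁ × e ≡ pathEdge t) ⊎ (∃ λ i → ∃ λ j → i < n × j < k × e ≡ starEdge i j)
  edge-cases e∈ with ∈-++⁻ (map pathEdge (upTo n₁)) e∈
  ... | inj₁ e∈path with ∈-map⁻ pathEdge e∈path
  ...   | t , t∈ , refl = inj₁ (t , ∈-upTo⁻ t∈ , refl)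
  edge-cases e∈ | inj₂ e∈star with find (∈-concatMap⁻ starRow {xs = upTo n} e∈star)
  ...   | i , i∈ , e∈row with ∈-map⁻ (starEdge i) e∈row
  ...     | j , j∈ , refl = inj₂ (i , j , ∈-upTo⁻ i∈ , ∈-upTo⁻ j∈ , refl)

  pathTerm : (ℕ → ℕ) → ℕ → ℕ → ℕ
  pathTerm L x t = contribution x (pathEdge t) (L t)

  starTerm : (ℕ → ℕ) → ℕ → ℕ → ℕ → ℕ
  starTerm L x i j = contribution x (starEdge i j) (L (starPos i j))

  starRowSum : (ℕ → ℕ) → ℕ → ℕ → ℕ
  starRowSum L x i = Σ< k (starTerm L x i)

  pathSum starSum : (ℕ → ℕ) → ℕ → ℕ
  pathSum L x = Σ< n₁ (pathTerm L x)
  starSum L x = Σ< n (starRowSum L x)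

  ω : (ℕ → ℕ) → ℕ → ℕ
  ω L x = pathSum L x + starSum L x

  weight≡ω : ∀ f L → (∀ e → label FG f e ≡ L (toℕ e)) → ∀ x → weight FG f x ≡ ω L x
  weight≡ω f L label≡ x = begin
    weight FG f x
      ≡⟨ weight≡incidenceSum FG f L label≡ x ⟩
    incidenceSum x (map pathEdge (upTo n₁) ++ concatMap starRow (upTo n)) L
      ≡⟨ incidenceSum-++ x (map pathEdge (upTo n₁)) _ L ⟩
    incidenceSum x (map pathEdge (upTo n₁)) L
      + incidenceSum x (concatMap starRow (upTo n)) (λ t → L (length (map pathEdge (upTo n₁)) + t))
      ≡⟨ cong₂ _+_ (incidenceSum-map x pathEdge id n₁ L) (begin
           incidenceSum x (concatMap starRow (upTo n)) (λ t → L (length (map pathEdge (upTo n₁)) + t))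
             ≡⟨ incidenceSum-cong x (concatMap starRow (upTo n)) (λ t → cong (λ ℓ → L (ℓ + t)) length-pathEdges) ⟩
           incidenceSum x (concatMap starRow (upTo n)) (λ t → L (n₁ + t))
             ≡⟨ incidenceSum-concatMap x k starRow length-starRow id n (λ t → L (n₁ + t)) ⟩
           Σ< n (λ i → incidenceSum x (starRow i) (λ j → L (starPos i j)))
             ≡⟨ Σ<-cong n (λ {i} _ → incidenceSum-map x (starEdge i) id k (λ j → L (starPos i j))) ⟩
           Σ< n (λ i → Σ< k (λ j → contribution x (starEdge i j) (L (starPos i j)))) ∎) ⟩
    ω L x ∎
    where open ≡-Reasoning

  pathRight : (ℕ → ℕ) → ℕ → ℕ
  pathRight a i = if i <ᵇ n₁ then a i else 0

  starSum-vtx : ∀ L {i j} → i < n → j < k → starSum L (vtx i j) ≡ L (starPos i j)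
  starSum-vtx L {i} {j} i<n j<k = begin
    Σ< n (starRowSum L x)
      ≡⟨ Σ<-single n (starRowSum L x) i<n (λ {i′} i′<n i′≢i → Σ<-zero k (starTerm L x i′) λ {j′} j′<k →
           contribution-absent _ (centre≢x i′<n) (i′≢i ∘ proj₁ ∘ vtx-injective {i′} {j′} {i} {j} j′<k j<k)) ⟩
    Σ< k (starTerm L x i)
      ≡⟨ Σ<-single k (starTerm L x i) j<k (λ {j′} j′<k j′≢j →
           contribution-absent _ (centre≢x i<n) (j′≢j ∘ proj₂ ∘ vtx-injective {i} {j′} {i} {j} j′<k j<k)) ⟩
    starTerm L x i j
      ≡⟨ contribution-snd _ (centre≢x i<n) ⟩
    L (starPos i j) ∎
    where
    open ≡-Reasoning
    x : ℕ
    x = vtx i j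
    centre≢x : ∀ {i′} → i′ < n → i′ ≢ x
    centre≢x i′<n = ≢-sym (vtx≢centre i j i′<n)

  pathSum-centre : ∀ L {x} → x < n → pathSum L x ≡ 0
  pathSum-centre L {x} x<n = Σ<-zero n₁ (pathTerm L x) λ {t} _ →
    contribution-absent _ (vtx≢centre t 0 x<n) (vtx≢centre (suc t) 0 x<n)

  ω-centre : ∀ L {x} → x < n → ω L x ≡ Σ< k (λ j → L (starPos x j))
  ω-centre L {x} x<n = cong₂ _+_ (pathSum-centre L x<n) (begin
    Σ< n (starRowSum L x)
      ≡⟨ Σ<-single n (starRowSum L x) x<n (λ {i} _ i≢x →
           Σ<-zero k (starTerm L x i) λ {j} _ → contribution-absent _ i≢x (vtx≢centre i j x<n)) ⟩
    Σ< k (starTerm L x x)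
      ≡⟨ Σ<-cong k {h′ = λ j → L (starPos x j)} (λ {j} _ → contribution-fst {x} (vtx x j) _) ⟩
    Σ< k (λ j → L (starPos x j)) ∎)
    where open ≡-Reasoning

  ω-leaf : ∀ L {i j} → i < n → 0 < j → j < k → ω L (vtx i j) ≡ L (starPos i j)
  ω-leaf L {i} {j} i<n 0<j j<k = cong₂ _+_
    (Σ<-zero n₁ (pathTerm L (vtx i j)) λ {t} _ → contribution-absent _ (vtx0≢leaf t) (vtx0≢leaf (suc t)))
    (starSum-vtx L i<n j<k)
    where
    vtx0≢leaf : ∀ t → vtx t 0 ≢ vtx i j
    vtx0≢leaf t eq = <⇒≢ 0<j (proj₂ (vtx-injective {t} {0} {i} {j} (s≤s z≤n) j<k eq))

  ω-pathVertex : ∀ L {i} → i < n → ω L (vtx i 0) ≡ pathLeft L i + pathRight L i + L (starPos i 0)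
  ω-pathVertex L {i} i<n = cong₂ _+_ pathPart (starSum-vtx L i<n (s≤s z≤n))
    where
    x : ℕ
    x = vtx i 0
    vtx0-injective : ∀ {a b} → vtx a 0 ≡ vtx b 0 → a ≡ b
    vtx0-injective {a} {b} = proj₁ ∘ vtx-injective {a} {0} {b} {0} (s≤s z≤n) (s≤s z≤n)
    pathTerm-split : ∀ t → pathTerm L x t ≡ (if t ≡ᵇ i then L t else 0) + (if suc t ≡ᵇ i then L t else 0)
    pathTerm-split t = trans (contribution-split {x} {vtx t 0} {vtx (suc t) 0} (L t) λ t-hits s-hits →
        1+n≢n (trans (vtx0-injective {suc t} {i} s-hits) (sym (vtx0-injective {t} {i} t-hits))))
      (cong₂ (λ b b′ → (if b then L t else 0) + (if b′ then L t else 0))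
        (≡ᵇ-injective (λ a → vtx a 0) vtx0-injective t i) (≡ᵇ-injective (λ a → vtx a 0) vtx0-injective (suc t) i))
    leftEdge : ∀ i r → i ≤ r → Σ< r (λ t → if suc t ≡ᵇ i then L t else 0) ≡ pathLeft L i
    leftEdge zero     r _          = Σ<-zero r (λ _ → 0) λ _ → refl
    leftEdge (suc i′) r i′<r rewrite Σ<-indicator r i′ L | dec-true (i′ <? r) i′<r = refl
    pathPart : pathSum L x ≡ pathLeft L i + pathRight L i
    pathPart = begin
      pathSum L x
        ≡⟨ Σ<-cong n₁ (λ {t} _ → pathTerm-split t) ⟩
      Σ< n₁ (λ t → (if t ≡ᵇ i then L t else 0) + (if suc t ≡ᵇ i then L t else 0))
        ≡⟨ Σ<-+ n₁ _ _ ⟩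
      Σ< n₁ (λ t → if t ≡ᵇ i then L t else 0) + Σ< n₁ (λ t → if suc t ≡ᵇ i then L t else 0)
        ≡⟨ cong₂ _+_ (Σ<-indicator n₁ i L) (leftEdge i n₁ (s≤s⁻¹ i<n)) ⟩
      pathRight L i + pathLeft L i
        ≡⟨ +-comm (pathRight L i) (pathLeft L i) ⟩
      pathLeft L i + pathRight L i ∎
      where open ≡-Reasoning

  starPos-injective : ∀ {i j i′ j′} → j < k → j′ < k → starPos i j ≡ starPos i′ j′ → i ≡ i′ × j ≡ j′
  starPos-injective j<k j′<k eq = *+-injective k j<k j′<k (+-cancelˡ-≡ n₁ _ _ eq)

  starPos< : ∀ {i j} → i < n → j < k → starPos i j < m
  starPos< i<n j<k = +-monoʳ-< n₁ (*+-< k i<n j<k)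

  vtx< : ∀ {i j} → i < n → j < k → vtx i j < n + n * k
  vtx< {i} {j} i<n j<k = subst (_< n + n * k) (sym (+-assoc n (i * k) j)) (+-monoʳ-< n (*+-< k i<n j<k))

  leafRow leafCol : ℕ → ℕ
  leafRow s = s / k′
  leafCol s = suc (s % k′)

  leafRow< : ∀ {s} → s < n * k′ → leafRow s < n
  leafRow< = m<n*o⇒m/o<n

  leafCol< : ∀ s → leafCol s < k
  leafCol< s = s≤s (m%n<n s k′)

  leaf-injective : ∀ {s s′} → leafRow s ≡ leafRow s′ → leafCol s ≡ leafCol s′ → s ≡ s′
  leaf-injective {s} {s′} row≡ col≡ = begin
    s                              ≡⟨ *+-decompose k′ s ⟩
    leafRow s * k′ + s % k′        ≡⟨ cong₂ (λ a b → a * k′ + b) row≡ (suc-injective col≡) ⟩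
    leafRow s′ * k′ + s′ % k′      ≡⟨ *+-decompose k′ s′ ⟨
    s′                             ∎
    where open ≡-Reasoning

  leaf : ℕ → ℕ
  leaf s = vtx (leafRow s) (leafCol s)

  leafIndex : ℕ → ℕ → ℕ
  leafIndex i j = i * k′ + pred j

  leafIndex< : ∀ {i j} → i < n → 0 < j → j < k → leafIndex i j < n * k′
  leafIndex< i<n (s≤s z≤n) (s≤s j<k) = *+-< k′ i<n j<k

  leafRow-leafIndex : ∀ i {j} → 0 < j → j < k → leafRow (leafIndex i j) ≡ i
  leafRow-leafIndex i (s≤s z≤n) (s≤s j<k) = [i*k+j]/k≡i k′ i j<k

  leafCol-leafIndex : ∀ i {j} → 0 < j → j < k → leafCol (leafIndex i j) ≡ j
  leafCol-leafIndex i {suc j} _ (s≤s j<k) = cong suc ([i*k+j]%k≡j k′ i j<k)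

  module LowerBound (f : Labeling FG) (f-bijective : Bijective _≡_ _≡_ f) where

    L : ℕ → ℕ
    L = labelAt FG f

    W : ℕ → ℕ
    W = weight FG f

    W≡ω : ∀ x → W x ≡ ω L x
    W≡ω = weight≡ω f L (label≡labelAt FG f)

    L-bounds : ∀ {t} → t < m → 1 ≤ L t × L t ≤ m
    L-bounds {t} t<m = subst (λ M → 1 ≤ L t × L t ≤ M) numEdges-FG (labelAt-bounds FG f (subst (t <_) (sym numEdges-FG) t<m))

    L-injective : ∀ {t t′} → t < m → t′ < m → L t ≡ L t′ → t ≡ t′
    L-injective t<m t′<m = labelAt-injective FG (proj₁ f-bijective)
      (subst (_ <_) (sym numEdges-FG) t<m) (subst (_ <_) (sym numEdges-FG) t′<m)

    L-top : ∃ λ t → t < m × L t ≡ m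
    L-top with labelAt-top FG (proj₂ f-bijective) (subst (0 <_) (sym numEdges-FG) (<-≤-trans (s≤s z≤n) (m≤n+m (n * k) n₁)))
    ... | t , t<M , Lt≡M = t , subst (t <_) numEdges-FG t<M , trans Lt≡M numEdges-FG

    W-leaf : ∀ {i j} → i < n → 0 < j → j < k → W (vtx i j) ≡ L (starPos i j)
    W-leaf i<n 0<j j<k = trans (W≡ω _) (ω-leaf L i<n 0<j j<k)

    heavyVertex : ∃ λ v → v < n + n * k × m < W v
    heavyVertex with L-top
    ... | t , t<m , Lt≡m with position-cases t<m
    ...   | inj₁ t<n₁ = vtx t 0 , vtx< (m≤n⇒m≤1+n t<n₁) (s≤s z≤n) , (begin-strict
      m                                                  <⟨ m<m+n m (proj₁ (L-bounds (starPos< (m≤n⇒m≤1+n t<n₁) (s≤s z≤n)))) ⟩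
      m + L (starPos t 0)                                ≤⟨ +-monoˡ-≤ _ (m≤n+m m (pathLeft L t)) ⟩
      pathLeft L t + m + L (starPos t 0)                 ≡⟨ cong (λ r → pathLeft L t + r + L (starPos t 0)) right≡m ⟨
      pathLeft L t + pathRight L t + L (starPos t 0)     ≡⟨ trans (W≡ω _) (ω-pathVertex L (m≤n⇒m≤1+n t<n₁)) ⟨
      W (vtx t 0)                                        ∎)
      where
      open ≤-Reasoning
      right≡m : pathRight L t ≡ m
      right≡m rewrite dec-true (t <? n₁) t<n₁ = Lt≡m
    ...   | inj₂ (i , j , i<n , j<k , refl) = i , ≤-trans i<n (m≤m+n n (n * k)) , (begin-strict
      m                  <⟨ heavyPair j j<k Lt≡m ⟩
      Σ< k (λ j → L (starPos i j)) ≡⟨ trans (W≡ω i) (ω-centre L i<n) ⟨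
      W i                ∎)
      where
      open ≤-Reasoning
      L≥1 : ∀ {j} → j < k → 1 ≤ L (starPos i j)
      L≥1 j<k = proj₁ (L-bounds (starPos< i<n j<k))
      1<k : 1 < k
      1<k = s≤s (>-nonZero⁻¹ k′)
      heavyPair : ∀ j → j < k → L (starPos i j) ≡ m → m < Σ< k (λ j → L (starPos i j))
      heavyPair zero    _   L₀≡m = begin-strict
        m                                  <⟨ m<m+n m (L≥1 1<k) ⟩
        m + L (starPos i 1)                ≡⟨ cong (_+ L (starPos i 1)) L₀≡m ⟨
        L (starPos i 0) + L (starPos i 1)  ≤⟨ Σ<-pair≤ k (λ j → L (starPos i j)) (s≤s z≤n) 1<k ⟩
        Σ< k (λ j → L (starPos i j))       ∎
      heavyPair (suc j) j<k Lⱼ≡m = begin-strict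
        m                                      <⟨ m<n+m m (L≥1 (s≤s z≤n)) ⟩
        L (starPos i 0) + m                    ≡⟨ cong (L (starPos i 0) +_) Lⱼ≡m ⟨
        L (starPos i 0) + L (starPos i (suc j)) ≤⟨ Σ<-pair≤ k (λ j → L (starPos i j)) (s≤s z≤n) j<k ⟩
        Σ< k (λ j → L (starPos i j))           ∎

    W-leafAt : ∀ {s} → s < n * k′ → W (leaf s) ≡ L (starPos (leafRow s) (leafCol s))
    W-leafAt {s} s<N = W-leaf (leafRow< s<N) (s≤s z≤n) (leafCol< s)

    colour : ℕ → ℕ
    colour zero    = W (proj₁ heavyVertex)
    colour (suc s) = W (leaf s)

    colour-distinct : ∀ {s s′} → s < s′ → s′ < suc (n * k′) → colour s ≢ colour s′
    colour-distinct {zero} {suc s′} _ (s≤s s′<N) eq =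
      <⇒≱ (proj₂ (proj₂ heavyVertex)) (subst (_≤ m) (sym (trans eq (W-leafAt s′<N)))
        (proj₂ (L-bounds (starPos< (leafRow< s′<N) (leafCol< s′)))))
    colour-distinct {suc s} {suc s′} (s≤s s<s′) (s≤s s′<N) eq =
      <⇒≢ s<s′ (leaf-injective (proj₁ same-position) (proj₂ same-position))
      where
      s<N : s < n * k′
      s<N = <-trans s<s′ s′<N
      same-position : leafRow s ≡ leafRow s′ × leafCol s ≡ leafCol s′
      same-position = starPos-injective (leafCol< s) (leafCol< s′)
        (L-injective (starPos< (leafRow< s<N) (leafCol< s)) (starPos< (leafRow< s′<N) (leafCol< s′))
          (trans (sym (W-leafAt s<N)) (trans eq (W-leafAt s′<N))))

    colour-attained : ∀ {s} → s < suc (n * k′) → ∃ λ v → v < n + n * k × W v ≡ colour s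
    colour-attained {zero}  _          = proj₁ heavyVertex , proj₁ (proj₂ heavyVertex) , refl
    colour-attained {suc s} (s≤s s<N) = leaf s , vtx< (leafRow< s<N) (leafCol< s) , refl

    lowerBound : suc (n * k′) ≤ numColors FG f
    lowerBound = ≤countDistinct W (n + n * k) (suc (n * k′)) colour colour-distinct colour-attained

pathWeight : (ℕ → ℕ) → (ℕ → ℕ → ℕ) → ℕ → ℕ
pathWeight a b i = pathLeft a i + a i + b i 0

record IsScheme (n₁ k : ℕ) (a : ℕ → ℕ) (b : ℕ → ℕ → ℕ) (c : ℕ) : Set where
  field
    pathLabel-bounds    : ∀ {t} → t < n₁ → 1 ≤ a t × a t ≤ edgeCount n₁ k
    starLabel-bounds    : ∀ {i} → i < suc n₁ → ∀ {j} → j < k → 1 ≤ b i j × b i j ≤ edgeCount n₁ k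
    pathLabel-injective : ∀ {t} → t < n₁ → ∀ {t′} → t′ < n₁ → a t ≡ a t′ → t ≡ t′
    starLabel-injective : ∀ {i} → i < suc n₁ → ∀ {j} → j < k → ∀ {i′} → i′ < suc n₁ → ∀ {j′} → j′ < k →
                          b i j ≡ b i′ j′ → i ≡ i′ × j ≡ j′
    pathLabel≢starLabel : ∀ {t} → t < n₁ → ∀ {i} → i < suc n₁ → ∀ {j} → j < k → a t ≢ b i j
    -- the path labels are padded with 0 at n₁, so pathWeight needs no case for the last path vertex
    pathLabel-end       : a n₁ ≡ 0
    centre-sum          : ∀ {i} → i < suc n₁ → Σ< k (b i) ≡ c
    edgeCount<centre    : edgeCount n₁ k < c
    pathWeight-leaf     : ∀ {i} → i < suc n₁ →
                          ∃ λ i′ → i′ < suc n₁ × ∃ λ j′ → j′ < k × 0 < j′ × pathWeight a b i ≡ b i′ j′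
    pathWeight-adjacent : ∀ {i} → i < n₁ → pathWeight a b i ≢ pathWeight a b (suc i)

  1<k : 1 < k
  1<k = let _ , _ , _ , j<k , 0<j , _ = pathWeight-leaf (s≤s z≤n) in ≤-<-trans 0<j j<k

inRange? : ∀ m x → Dec (1 ≤ x × x ≤ m)
inRange? m x = (1 ≤? x) ×-dec (x ≤? m)

isScheme? : ∀ n₁ k a b c → Dec (IsScheme n₁ k a b c)
isScheme? n₁ k a b c
  with allUpTo? (λ t → inRange? (edgeCount n₁ k) (a t)) n₁
  ×-dec allUpTo? (λ i → allUpTo? (λ j → inRange? (edgeCount n₁ k) (b i j)) k) (suc n₁)
  ×-dec allUpTo? (λ t → allUpTo? (λ t′ → (a t ≟ a t′) →-dec (t ≟ t′)) n₁) n₁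
  ×-dec allUpTo? (λ i → allUpTo? (λ j → allUpTo? (λ i′ → allUpTo? (λ j′ →
          (b i j ≟ b i′ j′) →-dec ((i ≟ i′) ×-dec (j ≟ j′))) k) (suc n₁)) k) (suc n₁)
  ×-dec allUpTo? (λ t → allUpTo? (λ i → allUpTo? (λ j → ¬? (a t ≟ b i j)) k) (suc n₁)) n₁
  ×-dec a n₁ ≟ 0
  ×-dec allUpTo? (λ i → Σ< k (b i) ≟ c) (suc n₁)
  ×-dec edgeCount n₁ k <? c
  ×-dec allUpTo? (λ i → anyUpTo? (λ i′ → anyUpTo? (λ j′ →
          (0 <? j′) ×-dec (pathWeight a b i ≟ b i′ j′)) k) (suc n₁)) (suc n₁)
  ×-dec allUpTo? (λ i → ¬? (pathWeight a b i ≟ pathWeight a b (suc i))) n₁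
... | yes (p₁ , p₂ , p₃ , p₄ , p₅ , p₆ , p₇ , p₈ , p₉ , p₁₀) = yes record
  { pathLabel-bounds = p₁ ; starLabel-bounds = p₂ ; pathLabel-injective = p₃ ; starLabel-injective = p₄
  ; pathLabel≢starLabel = p₅ ; pathLabel-end = p₆ ; centre-sum = p₇ ; edgeCount<centre = p₈
  ; pathWeight-leaf = p₉ ; pathWeight-adjacent = p₁₀ }
... | no ¬conditions = no λ s → let open IsScheme s in ¬conditions
  ( pathLabel-bounds , starLabel-bounds , pathLabel-injective , starLabel-injective , pathLabel≢starLabel
  , pathLabel-end , centre-sum , edgeCount<centre , pathWeight-leaf , pathWeight-adjacent )

columnwise-injective : ∀ {n k} (b : ℕ → ℕ → ℕ) →
  (∀ {i i′ j j′} → i < n → i′ < n → j < j′ → j′ < k → b i j < b i′ j′) →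
  (∀ {i i′ j} → i < n → i′ < n → j < k → b i j ≡ b i′ j → i ≡ i′) →
  ∀ {i} → i < n → ∀ {j} → j < k → ∀ {i′} → i′ < n → ∀ {j′} → j′ < k →
  b i j ≡ b i′ j′ → i ≡ i′ × j ≡ j′
columnwise-injective b ordered column-injective i<n {j} j<k i′<n {j′} j′<k eq with <-cmp j j′
... | tri< j<j′ _ _ = contradiction eq (<⇒≢ (ordered i<n i′<n j<j′ j′<k))
... | tri≈ _ refl _ = column-injective i<n i′<n j<k eq , refl
... | tri> _ _ j′<j = contradiction (sym eq) (<⇒≢ (ordered i′<n i<n j′<j j<k))

record Scheme (n₁ k : ℕ) : Set where
  field
    pathLabel : ℕ → ℕ
    starLabel : ℕ → ℕ → ℕ
    centre    : ℕ
    isScheme  : IsScheme n₁ k pathLabel starLabel centre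

module Extension {n₁ k : ℕ} (S : Scheme n₁ k) where
  open Scheme S
  open IsScheme isScheme

  n m : ℕ
  n = suc n₁
  m = edgeCount n₁ k

  newLabel : ℕ → ℕ → ℕ
  newLabel i zero    = m + suc i
  newLabel i (suc _) = m + (n + (n ∸ i))

  starLabel′ : ℕ → ℕ → ℕ
  starLabel′ i j = if j <ᵇ k then starLabel i j else newLabel i (j ∸ k)

  centre′ : ℕ
  centre′ = centre + suc ((m + n) + (m + n))

  edgeCount-extended : edgeCount n₁ (2 + k) ≡ m + (n + n)
  edgeCount-extended = identity n₁ k
    where
    identity : ∀ a b → a + suc a * (2 + b) ≡ (a + suc a * b) + (suc a + suc a)
    identity = solve-∀

  starLabel′-old : ∀ i {j} → j < k → starLabel′ i j ≡ starLabel i j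
  starLabel′-old i {j} j<k rewrite dec-true (j <? k) j<k = refl

  starLabel′-new : ∀ i u → starLabel′ i (k + u) ≡ newLabel i u
  starLabel′-new i u rewrite dec-false (k + u <? k) (m+n≮m k u) | m+n∸m≡n k u = refl

  column-cases : ∀ {j} → j < 2 + k → j < k ⊎ ∃ λ u → u < 2 × j ≡ k + u
  column-cases {j} j<2+k = split-<+ k (subst (j <_) (+-comm 2 k) j<2+k)

  newLabel-bounds : ∀ {i u} → i < n → u < 2 → m < newLabel i u × newLabel i u ≤ m + (n + n)
  newLabel-bounds {i} {zero}  i<n _ = m<m+n m (s≤s z≤n) , +-monoʳ-≤ m (≤-trans i<n (m≤m+n n n))
  newLabel-bounds {i} {suc _} i<n _ = m<m+n m (s≤s z≤n) , +-monoʳ-≤ m (+-monoʳ-≤ n (m∸n≤m n i))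

  first<second : ∀ {i i′} → i < n → i′ < n → newLabel i 0 < newLabel i′ 1
  first<second {i} {i′} i<n i′<n = +-monoʳ-< m (≤-<-trans i<n (m<m+n n (m<n⇒0<n∸m i′<n)))

  newLabel-injective : ∀ {i u i′ u′} → i < n → u < 2 → i′ < n → u′ < 2 →
                       newLabel i u ≡ newLabel i′ u′ → i ≡ i′ × u ≡ u′
  newLabel-injective {u = zero}  {u′ = zero}  _   _ _    _ eq = suc-injective (+-cancelˡ-≡ m _ _ eq) , refl
  newLabel-injective {u = suc zero} {u′ = suc zero} i<n _ i′<n _ eq =
    ∸-cancelˡ-≡ (<⇒≤ i<n) (<⇒≤ i′<n) (+-cancelˡ-≡ n _ _ (+-cancelˡ-≡ m _ _ eq)) , refl
  newLabel-injective {u = zero} {u′ = suc zero} i<n _ i′<n _ eq = contradiction eq (<⇒≢ (first<second i<n i′<n))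
  newLabel-injective {u = suc zero} {u′ = zero} i<n _ i′<n _ eq = contradiction eq (≢-sym (<⇒≢ (first<second i′<n i<n)))
  newLabel-injective {u = suc (suc _)} _ (s≤s (s≤s ()))
  newLabel-injective {u′ = suc (suc _)} _ _ _ (s≤s (s≤s ()))

  newLabel-sum : ∀ {i} → i < n → newLabel i 0 + newLabel i 1 ≡ suc ((m + n) + (m + n))
  newLabel-sum {i} i<n = sum≡ n (n ∸ i) (sym (m+[n∸m]≡n (<⇒≤ i<n)))
    where
    identity : ∀ m i r → m + suc i + (m + ((i + r) + r)) ≡ suc ((m + (i + r)) + (m + (i + r)))
    identity = solve-∀
    sum≡ : ∀ N r → N ≡ i + r → m + suc i + (m + (N + r)) ≡ suc ((m + N) + (m + N))
    sum≡ _ r refl = identity m i r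

  m≤extended : m ≤ edgeCount n₁ (2 + k)
  m≤extended = subst (m ≤_) (sym edgeCount-extended) (m≤m+n m (n + n))

  old<new : ∀ {x i u} → x ≤ m → i < n → u < 2 → x < newLabel i u
  old<new x≤m i<n u<2 = ≤-<-trans x≤m (proj₁ (newLabel-bounds i<n u<2))

  starLabel′-bounds : ∀ {i} → i < n → ∀ {j} → j < 2 + k →
                      1 ≤ starLabel′ i j × starLabel′ i j ≤ edgeCount n₁ (2 + k)
  starLabel′-bounds {i} i<n j<2+k with column-cases j<2+k
  ... | inj₁ j<k rewrite starLabel′-old i j<k =
    proj₁ (starLabel-bounds i<n j<k) , ≤-trans (proj₂ (starLabel-bounds i<n j<k)) m≤extended
  ... | inj₂ (u , u<2 , refl) rewrite starLabel′-new i u =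
    ≤-trans (s≤s z≤n) (proj₁ (newLabel-bounds i<n u<2)) ,
    subst (newLabel i u ≤_) (sym edgeCount-extended) (proj₂ (newLabel-bounds i<n u<2))

  starLabel′-injective : ∀ {i} → i < n → ∀ {j} → j < 2 + k → ∀ {i′} → i′ < n → ∀ {j′} → j′ < 2 + k →
                         starLabel′ i j ≡ starLabel′ i′ j′ → i ≡ i′ × j ≡ j′
  starLabel′-injective {i} i<n j<2+k {i′} i′<n j′<2+k eq with column-cases j<2+k | column-cases j′<2+k
  ... | inj₁ j<k | inj₁ j′<k =
    starLabel-injective i<n j<k i′<n j′<k (trans (sym (starLabel′-old i j<k)) (trans eq (starLabel′-old i′ j′<k)))
  ... | inj₁ j<k | inj₂ (u′ , u′<2 , refl) =
    contradiction (trans (sym (starLabel′-old i j<k)) (trans eq (starLabel′-new i′ u′)))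
    (<⇒≢ (old<new (proj₂ (starLabel-bounds i<n j<k)) i′<n u′<2))
  ... | inj₂ (u , u<2 , refl) | inj₁ j′<k =
    contradiction (trans (sym (starLabel′-old i′ j′<k)) (trans (sym eq) (starLabel′-new i u)))
    (<⇒≢ (old<new (proj₂ (starLabel-bounds i′<n j′<k)) i<n u<2))
  ... | inj₂ (u , u<2 , refl) | inj₂ (u′ , u′<2 , refl) =
    let i≡i′ , u≡u′ = newLabel-injective i<n u<2 i′<n u′<2
                        (trans (sym (starLabel′-new i u)) (trans eq (starLabel′-new i′ u′)))
    in  i≡i′ , cong (k +_) u≡u′

  pathLabel≢starLabel′ : ∀ {t} → t < n₁ → ∀ {i} → i < n → ∀ {j} → j < 2 + k → pathLabel t ≢ starLabel′ i j
  pathLabel≢starLabel′ {t} t<n₁ {i} i<n j<2+k with column-cases j<2+k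
  ... | inj₁ j<k rewrite starLabel′-old i j<k = pathLabel≢starLabel t<n₁ i<n j<k
  ... | inj₂ (u , u<2 , refl) rewrite starLabel′-new i u =
    <⇒≢ (old<new (proj₂ (pathLabel-bounds t<n₁)) i<n u<2)

  centre-sum′ : ∀ {i} → i < n → Σ< (2 + k) (starLabel′ i) ≡ centre′
  centre-sum′ {i} i<n = begin
    Σ< (2 + k) (starLabel′ i)
      ≡⟨ cong (λ r → Σ< r (starLabel′ i)) (+-comm 2 k) ⟩
    Σ< (k + 2) (starLabel′ i)
      ≡⟨ Σ<-split k 2 (starLabel′ i) ⟩
    Σ< k (starLabel′ i) + Σ< 2 (λ u → starLabel′ i (k + u))
      ≡⟨ cong₂ _+_ (trans (Σ<-cong k (starLabel′-old i)) (centre-sum i<n)) (Σ<-cong 2 (λ {u} _ → starLabel′-new i u)) ⟩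
    centre + (newLabel i 0 + (newLabel i 1 + 0))
      ≡⟨ cong (λ x → centre + (newLabel i 0 + x)) (+-identityʳ (newLabel i 1)) ⟩
    centre + (newLabel i 0 + newLabel i 1)
      ≡⟨ cong (centre +_) (newLabel-sum i<n) ⟩
    centre′ ∎
    where open ≡-Reasoning

  edgeCount<centre′ : edgeCount n₁ (2 + k) < centre′
  edgeCount<centre′ = subst (_< centre′) (sym edgeCount-extended)
    (+-mono-<-≤ edgeCount<centre (m≤n⇒m≤1+n (+-mono-≤ (m≤n+m n m) (m≤n+m n m))))

  pathWeight-unchanged : ∀ i → pathWeight pathLabel starLabel′ i ≡ pathWeight pathLabel starLabel i
  pathWeight-unchanged i = cong (pathLeft pathLabel i + pathLabel i +_) (starLabel′-old i (<-trans (s≤s z≤n) 1<k))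

  extend : Scheme n₁ (2 + k)
  extend = record
    { pathLabel = pathLabel
    ; starLabel = starLabel′
    ; centre    = centre′
    ; isScheme  = record
      { pathLabel-bounds    = λ t<n₁ → proj₁ (pathLabel-bounds t<n₁) , ≤-trans (proj₂ (pathLabel-bounds t<n₁)) m≤extended
      ; starLabel-bounds    = starLabel′-bounds
      ; pathLabel-injective = pathLabel-injective
      ; starLabel-injective = starLabel′-injective
      ; pathLabel≢starLabel = pathLabel≢starLabel′
      ; pathLabel-end       = pathLabel-end
      ; centre-sum          = centre-sum′
      ; edgeCount<centre    = edgeCount<centre′
      ; pathWeight-leaf     = λ {i} i<n →
          let i′ , i′<n , j′ , j′<k , 0<j′ , eq = pathWeight-leaf i<n
          in  i′ , i′<n , j′ , ≤-trans j′<k (m≤n+m k 2) , 0<j′ ,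
              trans (pathWeight-unchanged i) (trans eq (sym (starLabel′-old i′ j′<k)))
      ; pathWeight-adjacent = λ {i} i<n₁ eq → pathWeight-adjacent i<n₁
          (trans (sym (pathWeight-unchanged i)) (trans eq (pathWeight-unchanged (suc i))))
      }
    }

fromBases : ∀ {n₁ k} → Scheme n₁ k → Scheme n₁ (suc k) → ∀ d → Scheme n₁ (k + d)
fromBases {n₁} {k} S₀ S₁ d = subst (Scheme n₁) (+-comm d k) (go d)
  where
  go : ∀ d → Scheme n₁ (d + k)
  go zero          = S₀
  go (suc zero)    = S₁
  go (suc (suc d)) = Extension.extend (go d)

module SchemeLabelling {n₁ k′ : ℕ} .{{_ : NonZero k′}} (S : Scheme n₁ (suc k′)) where
  open Firecracker n₁ k′
  open Scheme S
  open IsScheme isScheme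

  L : ℕ → ℕ
  L t = if t <ᵇ n₁ then pathLabel t else starLabel ((t ∸ n₁) / k) ((t ∸ n₁) % k)

  L-path : ∀ {t} → t < n₁ → L t ≡ pathLabel t
  L-path {t} t<n₁ rewrite dec-true (t <? n₁) t<n₁ = refl

  L-star : ∀ i {j} → j < k → L (starPos i j) ≡ starLabel i j
  L-star i {j} j<k
    rewrite dec-false (starPos i j <? n₁) (m+n≮m n₁ _) | m+n∸m≡n n₁ (i * k + j)
          | [i*k+j]/k≡i k i j<k | [i*k+j]%k≡j k i j<k = refl

  L-bounds : ∀ {t} → t < m → 1 ≤ L t × L t ≤ m
  L-bounds t<m with position-cases t<m
  ... | inj₁ t<n₁ rewrite L-path t<n₁ = pathLabel-bounds t<n₁
  ... | inj₂ (i , j , i<n , j<k , refl) rewrite L-star i j<k = starLabel-bounds i<n j<k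

  L-injective : ∀ {t t′} → t < m → t′ < m → L t ≡ L t′ → t ≡ t′
  L-injective t<m t′<m eq with position-cases t<m | position-cases t′<m
  ... | inj₁ t<n₁ | inj₁ t′<n₁ =
    pathLabel-injective t<n₁ t′<n₁ (trans (sym (L-path t<n₁)) (trans eq (L-path t′<n₁)))
  ... | inj₁ t<n₁ | inj₂ (i , j , i<n , j<k , refl) =
    contradiction (trans (sym (L-path t<n₁)) (trans eq (L-star i j<k))) (pathLabel≢starLabel t<n₁ i<n j<k)
  ... | inj₂ (i , j , i<n , j<k , refl) | inj₁ t′<n₁ =
    contradiction (trans (sym (L-path t′<n₁)) (trans (sym eq) (L-star i j<k))) (pathLabel≢starLabel t′<n₁ i<n j<k)
  ... | inj₂ (i , j , i<n , j<k , refl) | inj₂ (i′ , j′ , i′<n , j′<k , refl) =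
    let i≡i′ , j≡j′ = starLabel-injective i<n j<k i′<n j′<k (trans (sym (L-star i j<k)) (trans eq (L-star i′ j′<k)))
    in  cong₂ starPos i≡i′ j≡j′

  <numEdges⇒<m : ∀ {t} → t < numEdges FG → t < m
  <numEdges⇒<m {t} = subst (t <_) numEdges-FG

  L-edgeBounds : ∀ {t} → t < numEdges FG → 1 ≤ L t × L t ≤ numEdges FG
  L-edgeBounds {t} t<M = subst (λ M → 1 ≤ L t × L t ≤ M) (sym numEdges-FG) (L-bounds (<numEdges⇒<m t<M))

  f : Labeling FG
  f = labelingFrom FG L L-edgeBounds

  W : ℕ → ℕ
  W = weight FG f

  W≡ω : ∀ x → W x ≡ ω L x
  W≡ω = weight≡ω f L (label-labelingFrom FG L L-edgeBounds)

  W-centre : ∀ {i} → i < n → W i ≡ centre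
  W-centre {i} i<n = begin
    W i                           ≡⟨ W≡ω i ⟩
    ω L i                         ≡⟨ ω-centre L i<n ⟩
    Σ< k (λ j → L (starPos i j))  ≡⟨ Σ<-cong k (L-star i) ⟩
    Σ< k (starLabel i)            ≡⟨ centre-sum i<n ⟩
    centre                        ∎
    where open ≡-Reasoning

  W-leaf : ∀ {i j} → i < n → 0 < j → j < k → W (vtx i j) ≡ starLabel i j
  W-leaf {i} i<n 0<j j<k = trans (W≡ω _) (trans (ω-leaf L i<n 0<j j<k) (L-star i j<k))

  W-pathVertex : ∀ {i} → i < n → W (vtx i 0) ≡ pathWeight pathLabel starLabel i
  W-pathVertex {i} i<n = trans (W≡ω _) (trans (ω-pathVertex L i<n)
    (cong₂ _+_ (cong₂ _+_ (left i i<n) right) (L-star i (s≤s z≤n))))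
    where
    left : ∀ i → i < n → pathLeft L i ≡ pathLeft pathLabel i
    left zero     _         = refl
    left (suc i′) (s≤s i′<n₁) = L-path i′<n₁
    right : pathRight L i ≡ pathLabel i
    right with i <? n₁
    ... | yes i<n₁ = trans (cong (λ b → if b then L i else 0) (dec-true (i <? n₁) i<n₁)) (L-path i<n₁)
    ... | no  i≮n₁ = trans (cong (λ b → if b then L i else 0) (dec-false (i <? n₁) i≮n₁))
                           (sym (trans (cong pathLabel (≤-antisym (s≤s⁻¹ i<n) (≮⇒≥ i≮n₁))) pathLabel-end))

  pathWeight≤m : ∀ {i} → i < n → pathWeight pathLabel starLabel i ≤ m
  pathWeight≤m i<n =
    let _ , i′<n , _ , j′<k , _ , eq = pathWeight-leaf i<n
    in  subst (_≤ m) (sym eq) (proj₂ (starLabel-bounds i′<n j′<k))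

  antimagic : ∀ e → W (proj₁ (lookup (edges FG) e)) ≢ W (proj₂ (lookup (edges FG) e))
  antimagic e with edge-cases (∈-lookup {xs = edges FG} e)
  ... | inj₁ (t , t<n₁ , eq) = subst (λ p → W (proj₁ p) ≢ W (proj₂ p)) (sym eq) λ same →
    pathWeight-adjacent t<n₁ (trans (sym (W-pathVertex (m≤n⇒m≤1+n t<n₁))) (trans same (W-pathVertex (s≤s t<n₁))))
  ... | inj₂ (i , zero , i<n , _ , eq) = subst (λ p → W (proj₁ p) ≢ W (proj₂ p)) (sym eq) λ same →
    <⇒≢ (≤-<-trans (pathWeight≤m i<n) edgeCount<centre) (trans (sym (W-pathVertex i<n)) (trans (sym same) (W-centre i<n)))
  ... | inj₂ (i , suc j , i<n , j<k , eq) = subst (λ p → W (proj₁ p) ≢ W (proj₂ p)) (sym eq) λ same →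
    <⇒≢ (≤-<-trans (proj₂ (starLabel-bounds i<n j<k)) edgeCount<centre)
        (trans (sym (W-leaf i<n (s≤s z≤n) j<k)) (trans (sym same) (W-centre i<n)))

  colour : ℕ → ℕ
  colour zero    = centre
  colour (suc s) = starLabel (leafRow s) (leafCol s)

  leaf-colour : ∀ {i j} → i < n → 0 < j → j < k → ∃ λ s → s < suc (n * k′) × starLabel i j ≡ colour s
  leaf-colour {i} {j} i<n 0<j j<k = suc (leafIndex i j) , s≤s (leafIndex< i<n 0<j j<k) ,
    sym (cong₂ starLabel (leafRow-leafIndex i 0<j j<k) (leafCol-leafIndex i 0<j j<k))

  colour-covers : ∀ {v} → v < n + n * k → ∃ λ s → s < suc (n * k′) × W v ≡ colour s
  colour-covers v<V with vertex-cases v<V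
  ... | inj₁ v<n = 0 , s≤s z≤n , W-centre v<n
  ... | inj₂ (i , zero , i<n , _ , refl) =
    let _ , i′<n , _ , j′<k , 0<j′ , eq = pathWeight-leaf i<n
        s , s<N , eq′ = leaf-colour i′<n 0<j′ j′<k
    in  s , s<N , trans (W-pathVertex i<n) (trans eq eq′)
  ... | inj₂ (i , suc j , i<n , j<k , refl) =
    let s , s<N , eq = leaf-colour i<n (s≤s z≤n) j<k
    in  s , s<N , trans (W-leaf i<n (s≤s z≤n) j<k) eq

  labelling : Σ (Labeling FG) λ f → IsLocalAntimagic FG f × numColors FG f ≤ suc (n * k′)
  labelling = f , (f-bijective , antimagic) , countDistinct≤ W (n + n * k) (suc (n * k′)) colour colour-covers
    where
    f-bijective : Bijective _≡_ _≡_ f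
    f-bijective = labelingFrom-bijective FG L L-edgeBounds λ t<M t′<M → L-injective (<numEdges⇒<m t<M) (<numEdges⇒<m t′<M)

-- With σ 0 = 0 the first path vertex of both families below would get weight 2n − 1, smaller than
-- every leaf label.
σ σ⁻¹ : ℕ → ℕ
σ 0 = 1
σ 1 = 2
σ 2 = 0
σ i = i
σ⁻¹ 0 = 2
σ⁻¹ 1 = 0
σ⁻¹ 2 = 1
σ⁻¹ i = i

σ⁻¹-σ : ∀ i → σ⁻¹ (σ i) ≡ i
σ⁻¹-σ 0 = refl
σ⁻¹-σ 1 = refl
σ⁻¹-σ 2 = refl
σ⁻¹-σ (suc (suc (suc i))) = refl

σ-injective : ∀ {i i′} → σ i ≡ σ i′ → i ≡ i′
σ-injective {i} {i′} eq = trans (sym (σ⁻¹-σ i)) (trans (cong σ⁻¹ eq) (σ⁻¹-σ i′))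

σ≤ : ∀ {i N} → 2 ≤ N → i ≤ N → σ i ≤ N
σ≤ {0}                   2≤N _   = ≤-trans (s≤s z≤n) 2≤N
σ≤ {1}                   2≤N _   = 2≤N
σ≤ {2}                   _   _   = z≤n
σ≤ {suc (suc (suc i))}   _   i≤N = i≤N

module LargeFamilies (q : ℕ) where

  n₁ n : ℕ
  n₁ = 4 + q
  n  = 5 + q

  σ≤n₁ : ∀ {i} → i < n → σ i ≤ n₁
  σ≤n₁ i<n = σ≤ (s≤s (s≤s z≤n)) (s≤s⁻¹ i<n)

  leafColumn : ℕ → ℕ → ℕ
  leafColumn base i = base + (n₁ ∸ σ i)

  leafColumn-bounds : ∀ base i → base ≤ leafColumn base i × leafColumn base i < base + n
  leafColumn-bounds base i = m≤m+n base _ , +-monoʳ-< base (s≤s (m∸n≤m n₁ (σ i)))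

  leafColumn-injective : ∀ base {i i′} → i < n → i′ < n → leafColumn base i ≡ leafColumn base i′ → i ≡ i′
  leafColumn-injective base i<n i′<n eq = σ-injective (∸-cancelˡ-≡ (σ≤n₁ i<n) (σ≤n₁ i′<n) (+-cancelˡ-≡ base _ _ eq))

  leafColumn-covers : ∀ base {x} → x < n → ∃ λ i → i < n × leafColumn base i ≡ base + x
  leafColumn-covers base x<n =
    let i , i<n , eq = injective⇒surjective-< (leafColumn 0) (λ {i} _ → proj₂ (leafColumn-bounds 0 i))
                         (leafColumn-injective 0) x<n
    in  i , i<n , cong (base +_) eq

  offset : ℕ → ℕ
  offset 0 = 0
  offset 1 = n₁
  offset 2 = q
  offset i = n₁ ∸ i

  offset< : ∀ {i} → i < n → offset i < n
  offset< {0}                 _ = s≤s z≤n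
  offset< {1}                 _ = ≤-refl
  offset< {2}                 _ = m<n+m q (s≤s z≤n)
  offset< {suc (suc (suc i))} _ = s≤s (m∸n≤m n₁ (3 + i))

  offset-adjacent : ∀ {i} → i < n₁ → offset i ≢ offset (suc i)
  offset-adjacent {0}                     _         = λ ()
  offset-adjacent {1}                     _         = m≢1+n+m q ∘ sym
  offset-adjacent {2}                     _         = 1+n≢n ∘ sym
  offset-adjacent {suc (suc (suc i))} (s≤s (s≤s (s≤s (s≤s i≤q)))) eq = 1+n≢n (trans (sym (+-∸-assoc 1 i≤q)) eq)

  n*2≡n+n : n * 2 ≡ n + n
  n*2≡n+n = trans (*-suc n 1) (cong (n +_) (*-identityʳ n))

  n*2≤edgeCount : ∀ k → n * 2 ≤ edgeCount n₁ (2 + k)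
  n*2≤edgeCount k = ≤-trans (*-monoʳ-≤ n (m≤m+n 2 k)) (m≤n+m (n * (2 + k)) n₁)

  n+σ<n*2 : ∀ {i} → i < n → n + σ i < n * 2
  n+σ<n*2 {i} i<n = subst (n + σ i <_) (sym n*2≡n+n) (+-monoʳ-< n (s≤s (σ≤n₁ i<n)))

  leafColumn≤ : ∀ base i → leafColumn base i ≤ base + n₁
  leafColumn≤ base i = +-monoʳ-≤ base (m∸n≤m n₁ (σ i))

  pathLabel₂ : ℕ → ℕ
  pathLabel₂ t = n₁ ∸ t

  starLabel₂ : ℕ → ℕ → ℕ
  starLabel₂ i zero    = n + σ i
  starLabel₂ i (suc _) = leafColumn (n * 2) i

  pathWeight₂ : ∀ {i} → i < n → pathWeight pathLabel₂ starLabel₂ i ≡ n * 2 + offset i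
  pathWeight₂ {0} _ = identity q
    where
    identity : ∀ q → 0 + (4 + q) + (5 + q + 1) ≡ (5 + q) * 2 + 0
    identity = solve-∀
  pathWeight₂ {1} _ = identity q
    where
    identity : ∀ q → (4 + q) + (3 + q) + (5 + q + 2) ≡ (5 + q) * 2 + (4 + q)
    identity = solve-∀
  pathWeight₂ {2} _ = identity q
    where
    identity : ∀ q → (3 + q) + (2 + q) + (5 + q + 0) ≡ (5 + q) * 2 + q
    identity = solve-∀
  pathWeight₂ {suc (suc (suc s))} (s≤s (s≤s (s≤s (s≤s s≤1+q)))) = begin
    ((2 + q) ∸ s) + r + (n + (3 + s))  ≡⟨ cong (λ x → x + r + (n + (3 + s))) (+-∸-assoc 1 s≤1+q) ⟩
    suc r + r + (n + (3 + s))          ≡⟨ identity₁ q s r ⟩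
    (s + r) + (r + q + 9)              ≡⟨ cong (_+ (r + q + 9)) (m+[n∸m]≡n s≤1+q) ⟩
    suc q + (r + q + 9)                ≡⟨ identity₂ q r ⟩
    n * 2 + r                          ∎
    where
    open ≡-Reasoning
    r = (1 + q) ∸ s
    identity₁ : ∀ q s r → suc r + r + (5 + q + (3 + s)) ≡ (s + r) + (r + q + 9)
    identity₁ = solve-∀
    identity₂ : ∀ q r → suc q + (r + q + 9) ≡ (5 + q) * 2 + r
    identity₂ = solve-∀

  scheme₂ : Scheme n₁ 2
  scheme₂ = record
    { pathLabel = pathLabel₂
    ; starLabel = starLabel₂
    ; centre    = n * 3 + n₁
    ; isScheme  = record
      { pathLabel-bounds    = λ {t} t<n₁ → m<n⇒0<n∸m t<n₁ , ≤-trans (m∸n≤m n₁ t) (m≤m+n n₁ _)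
      ; starLabel-bounds    = bounds
      ; pathLabel-injective = λ t<n₁ t′<n₁ → ∸-cancelˡ-≡ (<⇒≤ t<n₁) (<⇒≤ t′<n₁)
      ; starLabel-injective = columnwise-injective starLabel₂ ordered column-injective
      ; pathLabel≢starLabel = λ {t} _ {i} _ {j} j<2 →
          <⇒≢ (≤-<-trans (m∸n≤m n₁ t) (<-≤-trans (n<1+n n₁) (n≤starLabel i j<2)))
      ; pathLabel-end       = n∸n≡0 n₁
      ; centre-sum          = λ {i} i<n → trans (identity₁ n (σ i) (n₁ ∸ σ i)) (cong (n * 3 +_) (m+[n∸m]≡n (σ≤n₁ i<n)))
      ; edgeCount<centre    = subst (edgeCount n₁ 2 <_) (identity₂ n₁) (m<m+n (edgeCount n₁ 2) (s≤s z≤n))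
      ; pathWeight-leaf     = λ i<n → let i′ , i′<n , eq = leafColumn-covers (n * 2) (offset< i<n)
                                      in  i′ , i′<n , 1 , s≤s (s≤s z≤n) , s≤s z≤n , trans (pathWeight₂ i<n) (sym eq)
      ; pathWeight-adjacent = λ i<n₁ eq → offset-adjacent i<n₁ (+-cancelˡ-≡ (n * 2) _ _
          (trans (sym (pathWeight₂ (m≤n⇒m≤1+n i<n₁))) (trans eq (pathWeight₂ (s≤s i<n₁)))))
      }
    }
    where
    identity₁ : ∀ N s r → N + s + (N * 2 + r + 0) ≡ N * 3 + (s + r)
    identity₁ = solve-∀
    identity₂ : ∀ a → (a + suc a * 2) + suc a ≡ suc a * 3 + a
    identity₂ = solve-∀
    n≤starLabel : ∀ i {j} → j < 2 → n ≤ starLabel₂ i j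
    n≤starLabel i {0}     _ = m≤m+n n (σ i)
    n≤starLabel i {suc _} _ = ≤-trans n≤n*2 (m≤m+n (n * 2) _)
      where
      n≤n*2 : n ≤ n * 2
      n≤n*2 = m≤m*n n 2
    bounds : ∀ {i} → i < n → ∀ {j} → j < 2 → 1 ≤ starLabel₂ i j × starLabel₂ i j ≤ edgeCount n₁ 2
    bounds i<n {0}     _ = s≤s z≤n , ≤-trans (<⇒≤ (n+σ<n*2 i<n)) (n*2≤edgeCount 0)
    bounds {i} i<n {suc _} _ = s≤s z≤n , ≤-trans (leafColumn≤ (n * 2) i) (≤-reflexive (+-comm (n * 2) n₁))
    ordered : ∀ {i i′ j j′} → i < n → i′ < n → j < j′ → j′ < 2 → starLabel₂ i j < starLabel₂ i′ j′
    ordered {i′ = i′} {0} {1} i<n _ _ _ = <-≤-trans (n+σ<n*2 i<n) (proj₁ (leafColumn-bounds (n * 2) i′))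
    ordered {j = suc _} {1}           _ _ (s≤s ()) _
    ordered {j′ = suc (suc _)}        _ _ _ (s≤s (s≤s ()))
    column-injective : ∀ {i i′ j} → i < n → i′ < n → j < 2 → starLabel₂ i j ≡ starLabel₂ i′ j → i ≡ i′
    column-injective {j = 0}     _   _    _ eq = σ-injective (+-cancelˡ-≡ n _ _ eq)
    column-injective {j = suc _} i<n i′<n _ eq = leafColumn-injective (n * 2) i<n i′<n eq

  pathLabel₃ : ℕ → ℕ
  pathLabel₃ t = 2 * pathLabel₂ t

  starLabel₃ : ℕ → ℕ → ℕ
  starLabel₃ i 0             = suc (2 * σ i)
  starLabel₃ i 1             = leafColumn (n * 2) i
  starLabel₃ i (suc (suc _)) = leafColumn (n * 3) i

  pathWeight₃ : ∀ {i} → i < n → pathWeight pathLabel₃ starLabel₃ i ≡ n * 2 + suc (2 * offset i)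
  pathWeight₃ {i} i<n = +-cancelʳ-≡ (n * 2) _ _ (begin
    pathWeight pathLabel₃ starLabel₃ i + n * 2
      ≡⟨ cong (λ x → x + 2 * pathLabel₂ i + suc (2 * σ i) + n * 2) (pathLeft-double i) ⟩
    2 * pathLeft pathLabel₂ i + 2 * pathLabel₂ i + suc (2 * σ i) + n * 2
      ≡⟨ identity₁ (pathLeft pathLabel₂ i) (pathLabel₂ i) (σ i) n ⟩
    2 * pathWeight pathLabel₂ starLabel₂ i + 1
      ≡⟨ cong (λ x → 2 * x + 1) (pathWeight₂ i<n) ⟩
    2 * (n * 2 + offset i) + 1
      ≡⟨ identity₂ n (offset i) ⟩
    n * 2 + suc (2 * offset i) + n * 2 ∎)
    where
    open ≡-Reasoning
    pathLeft-double : ∀ i → pathLeft pathLabel₃ i ≡ 2 * pathLeft pathLabel₂ i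
    pathLeft-double zero    = refl
    pathLeft-double (suc _) = refl
    identity₁ : ∀ l a s N → 2 * l + 2 * a + suc (2 * s) + N * 2 ≡ 2 * (l + a + (N + s)) + 1
    identity₁ = solve-∀
    identity₂ : ∀ N o → 2 * (N * 2 + o) + 1 ≡ N * 2 + suc (2 * o) + N * 2
    identity₂ = solve-∀

  odd<n*2 : ∀ {x} → x ≤ n₁ → suc (2 * x) < n * 2
  odd<n*2 {x} x≤n₁ = subst (suc (2 * x) <_) (sym (identity q)) (s≤s (s≤s (*-monoʳ-≤ 2 x≤n₁)))
    where
    identity : ∀ q → (5 + q) * 2 ≡ suc (suc (2 * (4 + q)))
    identity = solve-∀

  scheme₃ : Scheme n₁ 3
  scheme₃ = record
    { pathLabel = pathLabel₃
    ; starLabel = starLabel₃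
    ; centre    = suc (n * 5 + 2 * n₁)
    ; isScheme  = record
      { pathLabel-bounds    = λ {t} t<n₁ →
          ≤-trans (m<n⇒0<n∸m t<n₁) (m≤m+n _ _) , ≤-trans (<⇒≤ (pathLabel<n*2 t)) (n*2≤edgeCount 1)
      ; starLabel-bounds    = bounds
      ; pathLabel-injective = λ t<n₁ t′<n₁ eq → ∸-cancelˡ-≡ (<⇒≤ t<n₁) (<⇒≤ t′<n₁) (*-cancelˡ-≡ _ _ 2 eq)
      ; starLabel-injective = columnwise-injective starLabel₃ ordered column-injective
      ; pathLabel≢starLabel = λ {t} _ {i} i<n {j} → pathLabel≢ t i<n j
      ; pathLabel-end       = cong (2 *_) (n∸n≡0 n₁)
      ; centre-sum          = λ {i} i<n → trans (identity₁ n (σ i) (n₁ ∸ σ i))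
                                                (cong (λ x → suc (n * 5 + 2 * x)) (m+[n∸m]≡n (σ≤n₁ i<n)))
      ; edgeCount<centre    = subst (edgeCount n₁ 3 <_) (sym (identity₂ q)) (s≤s (m≤m+n (edgeCount n₁ 3) (n * 2 + n₁)))
      ; pathWeight-leaf     = leaf
      ; pathWeight-adjacent = λ i<n₁ eq → offset-adjacent i<n₁ (*-cancelˡ-≡ _ _ 2 (suc-injective (+-cancelˡ-≡ (n * 2) _ _
          (trans (sym (pathWeight₃ (m≤n⇒m≤1+n i<n₁))) (trans eq (pathWeight₃ (s≤s i<n₁)))))))
      }
    }
    where
    identity₁ : ∀ N s r → suc (2 * s) + (N * 2 + r + (N * 3 + r + 0)) ≡ suc (N * 5 + 2 * (s + r))
    identity₁ = solve-∀
    identity₂ : ∀ q → suc ((5 + q) * 5 + 2 * (4 + q)) ≡ suc ((4 + q + (5 + q) * 3) + ((5 + q) * 2 + (4 + q)))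
    identity₂ = solve-∀
    pathLabel<n*2 : ∀ t → pathLabel₃ t < n * 2
    pathLabel<n*2 t = <-trans (n<1+n _) (odd<n*2 (m∸n≤m n₁ t))
    col0<n*2 : ∀ {i} → i < n → starLabel₃ i 0 < n * 2
    col0<n*2 i<n = odd<n*2 (σ≤n₁ i<n)
    n*2≤n*3 : n * 2 ≤ n * 3
    n*2≤n*3 = *-monoʳ-≤ n (n≤1+n 2)
    n*3≤edgeCount : n * 3 ≤ edgeCount n₁ 3
    n*3≤edgeCount = m≤n+m (n * 3) n₁
    bounds : ∀ {i} → i < n → ∀ {j} → j < 3 → 1 ≤ starLabel₃ i j × starLabel₃ i j ≤ edgeCount n₁ 3
    bounds     i<n {0} _ = s≤s z≤n , ≤-trans (<⇒≤ (col0<n*2 i<n)) (n*2≤edgeCount 1)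
    bounds {i} _   {1} _ = s≤s z≤n , ≤-trans (<⇒≤ (proj₂ (leafColumn-bounds (n * 2) i)))
                                       (≤-trans (≤-reflexive (identity₃ n)) n*3≤edgeCount)
      where
      identity₃ : ∀ N → N * 2 + N ≡ N * 3
      identity₃ = solve-∀
    bounds {i} _   {2} _ = s≤s z≤n , ≤-trans (leafColumn≤ (n * 3) i) (≤-reflexive (+-comm (n * 3) n₁))
    bounds _ {suc (suc (suc _))} (s≤s (s≤s (s≤s ())))
    ordered : ∀ {i i′ j j′} → i < n → i′ < n → j < j′ → j′ < 3 → starLabel₃ i j < starLabel₃ i′ j′
    ordered {i′ = i′} {0} {1} i<n _ _ _ = <-≤-trans (col0<n*2 i<n) (proj₁ (leafColumn-bounds (n * 2) i′))
    ordered {i′ = i′} {0} {2} i<n _ _ _ = <-≤-trans (col0<n*2 i<n) (≤-trans n*2≤n*3 (proj₁ (leafColumn-bounds (n * 3) i′)))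
    ordered {i} {i′} {1} {2} _ _ _ _ = <-≤-trans (subst (leafColumn (n * 2) i <_) (identity₃ n) (proj₂ (leafColumn-bounds (n * 2) i)))
                                                  (proj₁ (leafColumn-bounds (n * 3) i′))
      where
      identity₃ : ∀ N → N * 2 + N ≡ N * 3
      identity₃ = solve-∀
    ordered {j = suc _} {1}            _ _ (s≤s ()) _
    ordered {j = suc (suc _)} {2}      _ _ (s≤s (s≤s ())) _
    ordered {j′ = suc (suc (suc _))}   _ _ _ (s≤s (s≤s (s≤s ())))
    column-injective : ∀ {i i′ j} → i < n → i′ < n → j < 3 → starLabel₃ i j ≡ starLabel₃ i′ j → i ≡ i′
    column-injective {j = 0}           _   _    _ eq = σ-injective (*-cancelˡ-≡ _ _ 2 (suc-injective eq))
    column-injective {j = 1}           i<n i′<n _ eq = leafColumn-injective (n * 2) i<n i′<n eq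
    column-injective {j = suc (suc _)} i<n i′<n _ eq = leafColumn-injective (n * 3) i<n i′<n eq
    pathLabel≢ : ∀ t {i} → i < n → ∀ j → j < 3 → pathLabel₃ t ≢ starLabel₃ i j
    pathLabel≢ t {i} _ 0       _ = even≢odd (pathLabel₂ t) (σ i)
    pathLabel≢ t {i} _ (suc j) _ = <⇒≢ (<-≤-trans (pathLabel<n*2 t) (n*2≤leafLabel j))
      where
      n*2≤leafLabel : ∀ j → n * 2 ≤ starLabel₃ i (suc j)
      n*2≤leafLabel zero    = proj₁ (leafColumn-bounds (n * 2) i)
      n*2≤leafLabel (suc _) = ≤-trans n*2≤n*3 (proj₁ (leafColumn-bounds (n * 3) i))
    leaf : ∀ {i} → i < n →
           ∃ λ i′ → i′ < n × ∃ λ j′ → j′ < 3 × 0 < j′ × pathWeight pathLabel₃ starLabel₃ i ≡ starLabel₃ i′ j′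
    leaf {i} i<n with split-<+ n (subst (suc (2 * offset i) <_) n*2≡n+n (odd<n*2 (s≤s⁻¹ (offset< i<n))))
    ... | inj₁ x<n = let i′ , i′<n , eq = leafColumn-covers (n * 2) x<n
                     in  i′ , i′<n , 1 , s≤s (s≤s z≤n) , s≤s z≤n , trans (pathWeight₃ i<n) (sym eq)
    ... | inj₂ (y , y<n , x≡n+y) =
      let i′ , i′<n , eq = leafColumn-covers (n * 3) y<n
      in  i′ , i′<n , 2 , ≤-refl , s≤s z≤n , (begin
            pathWeight pathLabel₃ starLabel₃ i  ≡⟨ pathWeight₃ i<n ⟩
            n * 2 + suc (2 * offset i)           ≡⟨ cong (n * 2 +_) x≡n+y ⟩
            n * 2 + (n + y)                      ≡⟨ identity₃ n y ⟩
            n * 3 + y                            ≡⟨ eq ⟨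
            leafColumn (n * 3) i′                ∎)
      where
      open ≡-Reasoning
      identity₃ : ∀ N y → N * 2 + (N + y) ≡ N * 3 + y
      identity₃ = solve-∀

at : ∀ {A : Set} → A → List A → ℕ → A
at d []       _       = d
at d (x ∷ xs) zero    = x
at d (x ∷ xs) (suc i) = at d xs i

tableScheme : ∀ n₁ k (path : List ℕ) (stars : List (List ℕ)) c →
  {True (isScheme? n₁ k (at 0 path) (λ i → at 0 (at [] stars i)) c)} → Scheme n₁ k
tableScheme n₁ k path stars c {ok} = record
  { pathLabel = at 0 path
  ; starLabel = λ i → at 0 (at [] stars i)
  ; centre    = c
  ; isScheme  = toWitness ok
  }

scheme-2-2 : Scheme 1 2
scheme-2-2 = tableScheme 1 2 (1 ∷ []) ((2 ∷ 5 ∷ []) ∷ (4 ∷ 3 ∷ []) ∷ []) 7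

scheme-2-3 : Scheme 1 3
scheme-2-3 = tableScheme 1 3 (2 ∷ []) ((1 ∷ 5 ∷ 7 ∷ []) ∷ (4 ∷ 3 ∷ 6 ∷ []) ∷ []) 13

scheme-3-3 : Scheme 2 3
scheme-3-3 = tableScheme 2 3 (1 ∷ 2 ∷ []) ((3 ∷ 8 ∷ 10 ∷ []) ∷ (6 ∷ 4 ∷ 11 ∷ []) ∷ (5 ∷ 7 ∷ 9 ∷ []) ∷ []) 21

scheme-3-4 : Scheme 2 4
scheme-3-4 = tableScheme 2 4 (4 ∷ 5 ∷ [])
  ((3 ∷ 6 ∷ 9 ∷ 14 ∷ []) ∷ (2 ∷ 7 ∷ 10 ∷ 13 ∷ []) ∷ (1 ∷ 8 ∷ 11 ∷ 12 ∷ []) ∷ []) 32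

scheme-4-2 : Scheme 3 2
scheme-4-2 = tableScheme 3 2 (1 ∷ 2 ∷ 3 ∷ [])
  ((6 ∷ 9 ∷ []) ∷ (8 ∷ 7 ∷ []) ∷ (5 ∷ 10 ∷ []) ∷ (4 ∷ 11 ∷ []) ∷ []) 15

scheme-4-3 : Scheme 3 3
scheme-4-3 = tableScheme 3 3 (1 ∷ 2 ∷ 5 ∷ [])
  ((3 ∷ 11 ∷ 14 ∷ []) ∷ (7 ∷ 8 ∷ 13 ∷ []) ∷ (6 ∷ 10 ∷ 12 ∷ []) ∷ (9 ∷ 4 ∷ 15 ∷ []) ∷ []) 28

F₃,₂ : Graph
F₃,₂ = firecracker 3 2

labelling-3-2 : Σ (Labeling F₃,₂) λ f → IsLocalAntimagic F₃,₂ f × numColors F₃,₂ f ≤ 4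
labelling-3-2 = f , (labelingFrom-bijective F₃,₂ L L-bounds (λ t<8 t′<8 → L-injective t<8 t′<8) , antimagic) , colours
  where
  L : ℕ → ℕ
  L = at 0 (5 ∷ 4 ∷ 1 ∷ 7 ∷ 2 ∷ 6 ∷ 3 ∷ 8 ∷ [])
  L-bounds : ∀ {t} → t < 8 → 1 ≤ L t × L t ≤ 8
  L-bounds = from-yes (allUpTo? (λ t → inRange? 8 (L t)) 8)
  L-injective : ∀ {t} → t < 8 → ∀ {t′} → t′ < 8 → L t ≡ L t′ → t ≡ t′
  L-injective = from-yes (allUpTo? (λ t → allUpTo? (λ t′ → (L t ≟ L t′) →-dec (t ≟ t′)) 8) 8)
  f : Labeling F₃,₂
  f = labelingFrom F₃,₂ L L-bounds
  W : ℕ → ℕ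
  W = weight F₃,₂ f
  antimagic : ∀ e → W (proj₁ (lookup (edges F₃,₂) e)) ≢ W (proj₂ (lookup (edges F₃,₂) e))
  antimagic = from-yes (all? λ e → ¬? (W (proj₁ (lookup (edges F₃,₂) e)) ≟ W (proj₂ (lookup (edges F₃,₂) e))))
  colours : numColors F₃,₂ f ≤ 4
  colours = from-yes (numColors F₃,₂ f ≤? 4)

upperBound : ∀ n₂ k₂ → Σ (Labeling (firecracker (2 + n₂) (2 + k₂))) λ f →
  IsLocalAntimagic (firecracker (2 + n₂) (2 + k₂)) f × numColors (firecracker (2 + n₂) (2 + k₂)) f ≤ suc ((2 + n₂) * suc k₂)
upperBound 0       k₂       = SchemeLabelling.labelling (fromBases scheme-2-2 scheme-2-3 k₂)
upperBound 1       0        = labelling-3-2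
upperBound 1       (suc k₃) = SchemeLabelling.labelling (fromBases scheme-3-3 scheme-3-4 k₃)
upperBound 2       k₂       = SchemeLabelling.labelling (fromBases scheme-4-2 scheme-4-3 k₂)
upperBound (suc (suc (suc q))) k₂ =
  SchemeLabelling.labelling (fromBases (LargeFamilies.scheme₂ q) (LargeFamilies.scheme₃ q) k₂)

mainTheorem1 : (n k : ℕ) → 2 ≤ n → 2 ≤ k →
    LocalAntimagicChromaticNumber (firecracker n k) (n * k ∸ n + 1)
mainTheorem1 (suc (suc n₂)) (suc (suc k₂)) (s≤s (s≤s _)) (s≤s (s≤s _)) =
  let f , f-localAntimagic , f-colours = upperBound n₂ k₂
  in  ( f , f-localAntimagic
        , ≤-antisym (subst (numColors G f ≤_) (sym colours≡) f-colours) (lowerBound f (proj₁ f-localAntimagic)))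
    , λ g g-localAntimagic → lowerBound g (proj₁ g-localAntimagic)
  where
  n k : ℕ
  n = suc (suc n₂)
  k = suc (suc k₂)
  G : Graph
  G = firecracker n k
  colours≡ : n * k ∸ n + 1 ≡ suc (n * suc k₂)
  colours≡ = begin
    n * k ∸ n + 1              ≡⟨ cong (λ x → x ∸ n + 1) (*-suc n (suc k₂)) ⟩
    n + n * suc k₂ ∸ n + 1     ≡⟨ cong (_+ 1) (m+n∸m≡n n (n * suc k₂)) ⟩
    n * suc k₂ + 1             ≡⟨ +-comm (n * suc k₂) 1 ⟩
    suc (n * suc k₂)           ∎
    where open ≡-Reasoning
  lowerBound : ∀ g → Bijective _≡_ _≡_ g → n * k ∸ n + 1 ≤ numColors G g
  lowerBound g g-bijective =
    subst (_≤ numColors G g) (sym colours≡) (Firecracker.LowerBound.lowerBound (suc n₂) (suc k₂) g g-bijective)
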